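{- Let $k$ be an even positive integer and let $c_2\leq c_3$ be positive integers. Then the petal graph $P_{1,c_2,c_3}$ can be embedded in $K_k^*$ if and only if $k\geq6$, $c_2\geq3$, and $1+c_2+c_3\leq\frac{k^2}{2}$.
   Context: $K_k^*$ denotes the complete graph $K_k$ on vertices $v_0,\dotsc,v_{k-1}$ with a loop $v_iv_i$ added at every vertex. An embedding of a graph $G$ (simple graph possibly with at most one loop per vertex) in $K_k^*$ is a map $f:V(G)\to V(K_k^*)$ such that each edge $uv$ of $G$ is sent to the edge $f(u)f(v)$ of $K_k^*$ (a loop if $f(u)=f(v)$), and the induced map $E(G)\to E(K_k^*)$ is injective. The petal graph $P_{1,c_2,c_3}$ consists of a vertex $u_0$ with a loop at $u_0$, together with a cycle $u_0u^2_1\dotsb u^2_{c_2-1}u_0$ of length $c_2$ and a cycle $u_0u^3_1\dotsb u^3_{c_3-1}u_0$ of length $c_3$, these sharing only $u_0$. -}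

module Defs where

open import Data.Nat using (ℕ; zero; suc; _∸_; _<?_)
open import Data.Fin using (Fin; toℕ; fromℕ<)
open import Data.Product using (Σ; _×_; _,_)
open import Data.Sum using (_⊎_)
open import Relation.Nullary using (yes; no)
open import Relation.Binary.PropositionalEquality using (_≡_)

-- Vertices of the petal graph P_{1,c2,c3}:
--   hub        = u_0
--   in2 i      = u^2_{i+1}   (i < c2 - 1)
--   in3 i      = u^3_{i+1}   (i < c3 - 1)
data PVert (c2 c3 : ℕ) : Set where
  hub : PVert c2 c3
  in2 : Fin (c2 ∸ 1) → PVert c2 c3
  in3 : Fin (c3 ∸ 1) → PVert c2 c3

-- Edges of P_{1,c2,c3} (as a multigraph, indexed explicitly):
--   loop       = the loop u_0 u_0
--   e2 j       = j-th edge of the c2-cycle  (j < c2)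
--   e3 j       = j-th edge of the c3-cycle  (j < c3)
data PEdge (c2 c3 : ℕ) : Set where
  loop : PEdge c2 c3
  e2   : Fin c2 → PEdge c2 c3
  e3   : Fin c3 → PEdge c2 c3

-- The n-th vertex w_n of a cycle u_0 w_1 ... w_m u_0 of length m+1,
-- with w_0 = u_0 and w_n = u_0 for n > m (in particular w_{m+1} = u_0).
cycVert : {c2 c3 : ℕ} (m : ℕ) → (Fin m → PVert c2 c3) → ℕ → PVert c2 c3
cycVert m g zero = hub
cycVert m g (suc n) with n <? m
... | yes p = g (fromℕ< p)
... | no _  = hub

ends : {c2 c3 : ℕ} → PEdge c2 c3 → PVert c2 c3 × PVert c2 c3
ends loop = hub , hub
ends {c2} {c3} (e2 j) =
  cycVert (c2 ∸ 1) in2 (toℕ j) , cycVert (c2 ∸ 1) in2 (suc (toℕ j))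
ends {c2} {c3} (e3 j) =
  cycVert (c3 ∸ 1) in3 (toℕ j) , cycVert (c3 ∸ 1) in3 (suc (toℕ j))

SameEdge : {k : ℕ} → Fin k × Fin k → Fin k × Fin k → Set
SameEdge (x , y) (x' , y') = (x ≡ x' × y ≡ y') ⊎ (x ≡ y' × y ≡ x')

imageEdge : {k c2 c3 : ℕ} → (PVert c2 c3 → Fin k) → PEdge c2 c3 → Fin k × Fin k
imageEdge f e with ends e
... | (u , v) = f u , f v

IsEmbedding : (k c2 c3 : ℕ) → (PVert c2 c3 → Fin k) → Set
IsEmbedding k c2 c3 f =
  (e e' : PEdge c2 c3) → SameEdge (imageEdge f e) (imageEdge f e') → e ≡ e'

PetalEmbeds : (k c2 c3 : ℕ) → Set
PetalEmbeds k c2 c3 = Σ (PVert c2 c3 → Fin k) (IsEmbedding k c2 c3)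

-- Necessity is a degree count. The image of P_{1,c₂,c₃} is the loop at the hub together
-- with two closed walks, so every vertex has even degree; a vertex of K_k^* meets each of
-- its non-loop edges once and its loop twice, so its degree is at most k + 1, hence at
-- most k as k is even. Summing over the k vertices gives 2(1 + c₂ + c₃) ≤ k², the hub has
-- degree at least 6, and a cycle of length at most 2 would repeat an edge or use the loop.
--
-- Sufficiency is by induction on k, the cases k = 6 and k = 8 being checked by computation
-- on explicit embeddings. Passing from k = 2g + 2 to k + 2, the new edges at the two new
-- vertices can be arranged into a closed walk through the hub (a detour) of length 4t for
-- any t ≤ g + 1, and of length 4g + 6. Spliced into the longer cycle of an embedding in
-- K_k^*, such detours raise the admissible number of edges from 2(g + 1)² to 2(g + 2)².

module Submission where

open import Defs
open import Data.Nat
  using (ℕ; zero; suc; _+_; _*_; _∸_; _≤_; _<_; z≤n; s≤s; z<s; s≤s⁻¹; _≟_; _≤?_; _<?_; _<ᵇ_; _≤ᵇ_; _≡ᵇ_)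
open import Data.Nat.Properties
open import Data.Nat.Tactic.RingSolver using (solve-∀)
open import Data.Nat.Divisibility using (_∣_; divides)
open import Data.Fin using (Fin; toℕ; fromℕ<)
open import Data.Fin.Properties using (toℕ-injective; toℕ<n; toℕ-fromℕ<)
open import Data.Bool using (Bool; true; false; T; _∧_; _∨_; not; if_then_else_)
open import Data.Bool.Properties using (T-∧; T-∨)
open import Data.Bool.ListAction using (all)
open import Data.List using (List; []; _∷_; _++_; [_]; length)
open import Data.List.Properties using (length-++)
open import Data.Product using (Σ; _×_; _,_; proj₁; proj₂)
open import Data.Sum using (_⊎_; inj₁; inj₂)
open import Data.Unit using (⊤; tt)
open import Data.Empty using (⊥; ⊥-elim)
open import Function.Base using (_∘_)
open import Function.Bundles using (_⇔_; mk⇔; Equivalence)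
open import Function.Definitions using (Injective)
open import Relation.Nullary using (¬_; Dec; yes; no; does; _×-dec_; _⊎-dec_; contradiction)
open import Relation.Nullary.Decidable using (dec-true; dec-false)
open import Relation.Binary.PropositionalEquality
  using (_≡_; _≢_; refl; sym; trans; cong; cong₂; subst; subst₂; module ≡-Reasoning)

open Equivalence using (to; from)

Σ< : ℕ → (ℕ → ℕ) → ℕ
Σ< zero    f = 0
Σ< (suc n) f = Σ< n f + f n

Σ<-cong : ∀ n {f g} → (∀ i → i < n → f i ≡ g i) → Σ< n f ≡ Σ< n g
Σ<-cong zero    f≡g = refl
Σ<-cong (suc n) f≡g = cong₂ _+_ (Σ<-cong n (λ i i<n → f≡g i (m<n⇒m<1+n i<n))) (f≡g n ≤-refl)

Σ<-mono-≤ : ∀ n {f g} → (∀ i → i < n → f i ≤ g i) → Σ< n f ≤ Σ< n g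
Σ<-mono-≤ zero    f≤g = z≤n
Σ<-mono-≤ (suc n) f≤g = +-mono-≤ (Σ<-mono-≤ n (λ i i<n → f≤g i (m<n⇒m<1+n i<n))) (f≤g n ≤-refl)

Σ<-distrib-+ : ∀ n f g → Σ< n (λ i → f i + g i) ≡ Σ< n f + Σ< n g
Σ<-distrib-+ zero    f g = refl
Σ<-distrib-+ (suc n) f g = begin
  Σ< n (λ i → f i + g i) + (f n + g n) ≡⟨ cong (_+ (f n + g n)) (Σ<-distrib-+ n f g) ⟩
  Σ< n f + Σ< n g + (f n + g n)        ≡⟨ +-assoc (Σ< n f) (Σ< n g) _ ⟩
  Σ< n f + (Σ< n g + (f n + g n))      ≡⟨ cong (Σ< n f +_) (x+[y+z]≡y+[x+z] (Σ< n g) (f n) (g n)) ⟩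
  Σ< n f + (f n + (Σ< n g + g n))      ≡⟨ +-assoc (Σ< n f) (f n) _ ⟨
  Σ< n f + f n + (Σ< n g + g n)        ∎
  where
  open ≡-Reasoning
  x+[y+z]≡y+[x+z] : ∀ x y z → x + (y + z) ≡ y + (x + z)
  x+[y+z]≡y+[x+z] = solve-∀

Σ<-const : ∀ n c → Σ< n (λ _ → c) ≡ n * c
Σ<-const zero    c = refl
Σ<-const (suc n) c = trans (cong (_+ c) (Σ<-const n c)) (+-comm (n * c) c)

Σ<-zero : ∀ n {f} → (∀ i → i < n → f i ≡ 0) → Σ< n f ≡ 0
Σ<-zero n f≡0 = trans (Σ<-cong n f≡0) (trans (Σ<-const n 0) (*-zeroʳ n))

Σ<-distribʳ-* : ∀ n f c → Σ< n (λ i → f i * c) ≡ Σ< n f * c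
Σ<-distribʳ-* zero    f c = refl
Σ<-distribʳ-* (suc n) f c =
  trans (cong (_+ f n * c) (Σ<-distribʳ-* n f c)) (sym (*-distribʳ-+ c (Σ< n f) (f n)))

Σ<-comm : ∀ n m (f : ℕ → ℕ → ℕ) →
  Σ< n (λ i → Σ< m (λ j → f i j)) ≡ Σ< m (λ j → Σ< n (λ i → f i j))
Σ<-comm zero    m f = sym (Σ<-zero m (λ _ _ → refl))
Σ<-comm (suc n) m f = trans (cong (_+ Σ< m (f n)) (Σ<-comm n m f))
                            (sym (Σ<-distrib-+ m (λ j → Σ< n (λ i → f i j)) (f n)))

Σ<-shift : ∀ n f → Σ< n (λ i → f (suc i)) + f 0 ≡ Σ< n f + f n
Σ<-shift zero    f = refl
Σ<-shift (suc n) f = begin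
  Σ< n f∘suc + f (suc n) + f 0 ≡⟨ +-assoc (Σ< n f∘suc) _ _ ⟩
  Σ< n f∘suc + (f (suc n) + f 0) ≡⟨ cong (Σ< n f∘suc +_) (+-comm (f (suc n)) (f 0)) ⟩
  Σ< n f∘suc + (f 0 + f (suc n)) ≡⟨ +-assoc (Σ< n f∘suc) _ _ ⟨
  Σ< n f∘suc + f 0 + f (suc n)   ≡⟨ cong (_+ f (suc n)) (Σ<-shift n f) ⟩
  Σ< n f + f n + f (suc n)          ∎
  where
  open ≡-Reasoning
  f∘suc : ℕ → ℕ
  f∘suc i = f (suc i)

term≤Σ< : ∀ n f {i} → i < n → f i ≤ Σ< n f
term≤Σ< (suc n) f {i} i<1+n with m≤n⇒m<n∨m≡n (s≤s⁻¹ i<1+n)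
... | inj₁ i<n  = ≤-trans (term≤Σ< n f i<n) (m≤m+n (Σ< n f) (f n))
... | inj₂ refl = m≤n+m (f i) (Σ< n f)

two-terms≤Σ< : ∀ n f {i j} → i < j → j < n → f i + f j ≤ Σ< n f
two-terms≤Σ< (suc n) f {i} {j} i<j j<1+n with m≤n⇒m<n∨m≡n (s≤s⁻¹ j<1+n)
... | inj₁ j<n  = ≤-trans (two-terms≤Σ< n f i<j j<n) (m≤m+n (Σ< n f) (f n))
... | inj₂ refl = +-monoˡ-≤ (f j) (term≤Σ< j f i<j)

indicator : {A : Set} → Dec A → ℕ
indicator (yes _) = 1
indicator (no _)  = 0

indicator-yes : {A : Set} (d : Dec A) → A → indicator d ≡ 1
indicator-yes (yes _) _ = refl
indicator-yes (no ¬a) a = ⊥-elim (¬a a)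

indicator-no : {A : Set} (d : Dec A) → ¬ A → indicator d ≡ 0
indicator-no (yes a) ¬a = ⊥-elim (¬a a)
indicator-no (no _)  _  = refl

δ : ℕ → ℕ → ℕ
δ a v = indicator (a ≟ v)

δ-refl : ∀ v → δ v v ≡ 1
δ-refl v = indicator-yes (v ≟ v) refl

δ-sym : ∀ a v → δ a v ≡ δ v a
δ-sym a v with a ≟ v | v ≟ a
... | yes _   | yes _   = refl
... | no _    | no _    = refl
... | yes a≡v | no v≢a  = ⊥-elim (v≢a (sym a≡v))
... | no a≢v  | yes v≡a = ⊥-elim (a≢v (sym v≡a))

Σ<-δ-out : ∀ n a → n ≤ a → Σ< n (δ a) ≡ 0
Σ<-δ-out n a n≤a = Σ<-zero n δa≡0
  where
  δa≡0 : ∀ i → i < n → δ a i ≡ 0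
  δa≡0 i i<n = indicator-no (a ≟ i) (λ { refl → <⇒≱ i<n n≤a })

Σ<-δ : ∀ n a → a < n → Σ< n (δ a) ≡ 1
Σ<-δ (suc n) a a<1+n with m≤n⇒m<n∨m≡n (s≤s⁻¹ a<1+n)
... | inj₁ a<n  = cong₂ _+_ (Σ<-δ n a a<n) (indicator-no (a ≟ n) (<⇒≢ a<n))
... | inj₂ refl = cong₂ _+_ (Σ<-δ-out a a ≤-refl) (δ-refl a)

Edge : Set
Edge = ℕ × ℕ

infix 4 _≈ᵉ_ _≈ᵉ?_

_≈ᵉ_ : Edge → Edge → Set
(a , b) ≈ᵉ (c , d) = (a ≡ c × b ≡ d) ⊎ (a ≡ d × b ≡ c)

_≈ᵉ?_ : (e e' : Edge) → Dec (e ≈ᵉ e')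
(a , b) ≈ᵉ? (c , d) = ((a ≟ c) ×-dec (b ≟ d)) ⊎-dec ((a ≟ d) ×-dec (b ≟ c))

≈ᵉ-sym : ∀ {e e'} → e ≈ᵉ e' → e' ≈ᵉ e
≈ᵉ-sym (inj₁ (refl , refl)) = inj₁ (refl , refl)
≈ᵉ-sym (inj₂ (refl , refl)) = inj₂ (refl , refl)

≈ᵉ-trans : ∀ {e e' e''} → e ≈ᵉ e' → e' ≈ᵉ e'' → e ≈ᵉ e''
≈ᵉ-trans (inj₁ (refl , refl)) s = s
≈ᵉ-trans (inj₂ (refl , refl)) (inj₁ (refl , refl)) = inj₂ (refl , refl)
≈ᵉ-trans (inj₂ (refl , refl)) (inj₂ (refl , refl)) = inj₁ (refl , refl)

edge : (ℕ → ℕ) → ℕ → Edge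
edge σ i = σ i , σ (suc i)

DistinctEdges : (ℕ → ℕ) → ℕ → Set
DistinctEdges σ n = ∀ {i j} → i < n → j < n → edge σ i ≈ᵉ edge σ j → i ≡ j

DisjointEdges : (ℕ → ℕ) → ℕ → (ℕ → ℕ) → ℕ → Set
DisjointEdges σ n τ m = ∀ {i j} → i < n → j < m → ¬ edge σ i ≈ᵉ edge τ j

AvoidsLoop : ℕ → (ℕ → ℕ) → ℕ → Set
AvoidsLoop a σ n = ∀ {i} → i < n → ¬ (a , a) ≈ᵉ edge σ i

WalkIn : ℕ → (ℕ → ℕ) → ℕ → Set
WalkIn k σ n = ∀ {i} → i ≤ n → σ i < k

-- P_{1,c₂,c₃} drawn in K_k^* with hub a: two closed walks through a that use
-- pairwise distinct edges, none of them the loop at a.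
record Drawing (k a c₂ c₃ : ℕ) : Set where
  field
    σ₂ σ₃      : ℕ → ℕ
    hub<k      : a < k
    within₂    : WalkIn k σ₂ c₂
    within₃    : WalkIn k σ₃ c₃
    start₂     : σ₂ 0 ≡ a
    end₂       : σ₂ c₂ ≡ a
    start₃     : σ₃ 0 ≡ a
    end₃       : σ₃ c₃ ≡ a
    distinct₂  : DistinctEdges σ₂ c₂
    distinct₃  : DistinctEdges σ₃ c₃
    disjoint   : DisjointEdges σ₂ c₂ σ₃ c₃
    noLoop₂    : AvoidsLoop a σ₂ c₂
    noLoop₃    : AvoidsLoop a σ₃ c₃

-- Necessity: counting degrees

incidence : ℕ → Edge → ℕ
incidence v (x , y) = δ x v + δ y v

visits : (ℕ → ℕ) → ℕ → ℕ → ℕ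
visits σ n v = Σ< n (λ i → δ (σ i) v)

closedWalk-incidence : ∀ σ n v → σ 0 ≡ σ n →
  Σ< n (λ i → incidence v (edge σ i)) ≡ visits σ n v + visits σ n v
closedWalk-incidence σ n v closed =
  trans (Σ<-distrib-+ n (λ i → δ (σ i) v) (λ i → δ (σ (suc i)) v))
        (cong (visits σ n v +_) rotate)
  where
  rotate : Σ< n (λ i → δ (σ (suc i)) v) ≡ visits σ n v
  rotate = +-cancelʳ-≡ (δ (σ 0) v) _ _
    (trans (Σ<-shift n (λ i → δ (σ i) v)) (cong (λ x → visits σ n v + δ x v) (sym closed)))

multiplicity : (ℕ → Edge) → Edge → ℕ → ℕ
multiplicity g p n = Σ< n (λ i → indicator (g i ≈ᵉ? p))

multiplicity-zero : ∀ g p n → (∀ {i} → i < n → ¬ g i ≈ᵉ p) → multiplicity g p n ≡ 0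
multiplicity-zero g p n miss = Σ<-zero n (λ i i<n → indicator-no (g i ≈ᵉ? p) (miss i<n))

multiplicity-distinct : ∀ g p n → (∀ {i j} → i < n → j < n → g i ≈ᵉ g j → i ≡ j) →
  multiplicity g p n ≡ 0 ⊎ (multiplicity g p n ≡ 1 × Σ ℕ λ i → i < n × g i ≈ᵉ p)
multiplicity-distinct g p zero    inj = inj₁ refl
multiplicity-distinct g p (suc n) inj with g n ≈ᵉ? p
... | yes gn≈p = inj₂ (cong (_+ 1) (multiplicity-zero g p n earlier) , n , ≤-refl , gn≈p)
  where
  earlier : ∀ {i} → i < n → ¬ g i ≈ᵉ p
  earlier i<n gi≈p =
    <-irrefl (inj (m<n⇒m<1+n i<n) ≤-refl (≈ᵉ-trans gi≈p (≈ᵉ-sym gn≈p))) i<n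
... | no _ with multiplicity-distinct g p n (λ i<n j<n → inj (m<n⇒m<1+n i<n) (m<n⇒m<1+n j<n))
...   | inj₁ m≡0 = inj₁ (trans (+-identityʳ _) m≡0)
...   | inj₂ (m≡1 , i , i<n , gi≈p) = inj₂ (trans (+-identityʳ _) m≡1 , i , m<n⇒m<1+n i<n , gi≈p)

module Degrees {k a c₂ c₃ : ℕ} (D : Drawing k a c₂ c₃) where
  open Drawing D

  degree : ℕ → ℕ
  degree v = incidence v (a , a)
           + Σ< c₂ (λ i → incidence v (edge σ₂ i))
           + Σ< c₃ (λ i → incidence v (edge σ₃ i))

  occurrences : Edge → ℕ
  occurrences p = indicator ((a , a) ≈ᵉ? p) + multiplicity (edge σ₂) p c₂ + multiplicity (edge σ₃) p c₃

  occurrences≤1 : ∀ p → occurrences p ≤ 1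
  occurrences≤1 p with (a , a) ≈ᵉ? p
  ... | yes loop≈p
    rewrite multiplicity-zero (edge σ₂) p c₂ (λ i<c₂ e≈p → noLoop₂ i<c₂ (≈ᵉ-trans loop≈p (≈ᵉ-sym e≈p)))
          | multiplicity-zero (edge σ₃) p c₃ (λ i<c₃ e≈p → noLoop₃ i<c₃ (≈ᵉ-trans loop≈p (≈ᵉ-sym e≈p)))
          = ≤-refl
  ... | no _ with multiplicity-distinct (edge σ₂) p c₂ distinct₂
  ...   | inj₂ (m₂≡1 , i , i<c₂ , e≈p)
    rewrite m₂≡1
          | multiplicity-zero (edge σ₃) p c₃ (λ j<c₃ e'≈p → disjoint i<c₂ j<c₃ (≈ᵉ-trans e≈p (≈ᵉ-sym e'≈p)))
          = ≤-refl
  ...   | inj₁ m₂≡0 rewrite m₂≡0 with multiplicity-distinct (edge σ₃) p c₃ distinct₃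
  ...     | inj₁ m₃≡0 rewrite m₃≡0 = z≤n
  ...     | inj₂ (m₃≡1 , _) rewrite m₃≡1 = ≤-refl

  -- The loop at v meets v twice.
  weight : ℕ → ℕ → ℕ
  weight v u = 1 + δ u v

  matches : ℕ → Edge → ℕ
  matches v e = Σ< k (λ u → indicator (e ≈ᵉ? (v , u)) * weight v u)

  matching-term : ∀ v e u → e ≈ᵉ (v , u) → indicator (e ≈ᵉ? (v , u)) * weight v u ≡ weight v u
  matching-term v e u e≈vu = trans (cong (_* weight v u) (indicator-yes (e ≈ᵉ? (v , u)) e≈vu)) (*-identityˡ _)

  incidence≤matches : ∀ v x y → x < k → y < k → incidence v (x , y) ≤ matches v (x , y)
  incidence≤matches v x y x<k y<k = by-cases v x y x<k y<k (x ≟ v) (y ≟ v)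
    where
    open ≤-Reasoning
    by-cases : ∀ v x y → x < k → y < k → Dec (x ≡ v) → Dec (y ≡ v) → incidence v (x , y) ≤ matches v (x , y)
    by-cases v x y x<k y<k (yes refl) _ = begin
      δ x x + δ y x ≡⟨ cong (_+ δ y x) (δ-refl x) ⟩
      weight x y    ≡⟨ matching-term x (x , y) y (inj₁ (refl , refl)) ⟨
      _             ≤⟨ term≤Σ< k (λ u → indicator ((x , y) ≈ᵉ? (x , u)) * weight x u) y<k ⟩
      matches x (x , y) ∎
    by-cases v x y x<k y<k (no x≢v) (yes refl) = begin
      δ x y + δ y y ≡⟨ cong₂ _+_ (indicator-no (x ≟ y) x≢v) (δ-refl y) ⟩
      1             ≤⟨ s≤s z≤n ⟩
      weight y x    ≡⟨ matching-term y (x , y) x (inj₂ (refl , refl)) ⟨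
      _             ≤⟨ term≤Σ< k (λ u → indicator ((x , y) ≈ᵉ? (y , u)) * weight y u) x<k ⟩
      matches y (x , y) ∎
    by-cases v x y x<k y<k (no x≢v) (no y≢v) =
      ≤-trans (≤-reflexive (cong₂ _+_ (indicator-no (x ≟ v) x≢v) (indicator-no (y ≟ v) y≢v))) z≤n

  Σ<-matches : ∀ v n σ →
    Σ< n (λ i → matches v (edge σ i)) ≡ Σ< k (λ u → multiplicity (edge σ) (v , u) n * weight v u)
  Σ<-matches v n σ =
    trans (Σ<-comm n k (λ i u → indicator (edge σ i ≈ᵉ? (v , u)) * weight v u))
          (Σ<-cong k (λ u _ → Σ<-distribʳ-* n (λ i → indicator (edge σ i ≈ᵉ? (v , u))) (weight v u)))

  Σ<-weight : ∀ v → v < k → Σ< k (weight v) ≡ 1 + k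
  Σ<-weight v v<k = begin
    Σ< k (λ u → 1 + δ u v)      ≡⟨ Σ<-distrib-+ k (λ _ → 1) (λ u → δ u v) ⟩
    Σ< k (λ _ → 1) + Σ< k (λ u → δ u v) ≡⟨ cong₂ _+_ (trans (Σ<-const k 1) (*-identityʳ k))
                                                   (trans (Σ<-cong k (λ u _ → δ-sym u v)) (Σ<-δ k v v<k)) ⟩
    k + 1                       ≡⟨ +-comm k 1 ⟩
    1 + k                       ∎
    where open ≡-Reasoning

  degree≤1+k : ∀ v → v < k → degree v ≤ 1 + k
  degree≤1+k v v<k = begin
      degree v
    ≤⟨ +-mono-≤ (+-mono-≤ (incidence≤matches v a a hub<k hub<k)
                  (Σ<-mono-≤ c₂ (λ i i<c₂ → incidence≤matches v _ _ (within₂ (<⇒≤ i<c₂)) (within₂ i<c₂))))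
                  (Σ<-mono-≤ c₃ (λ i i<c₃ → incidence≤matches v _ _ (within₃ (<⇒≤ i<c₃)) (within₃ i<c₃))) ⟩
      matches v (a , a) + Σ< c₂ (λ i → matches v (edge σ₂ i)) + Σ< c₃ (λ i → matches v (edge σ₃ i))
    ≡⟨ cong₂ _+_ (cong (matches v (a , a) +_) (Σ<-matches v c₂ σ₂)) (Σ<-matches v c₃ σ₃) ⟩
      Σ< k (λ u → indicator ((a , a) ≈ᵉ? (v , u)) * weight v u)
        + Σ< k (λ u → multiplicity (edge σ₂) (v , u) c₂ * weight v u)
        + Σ< k (λ u → multiplicity (edge σ₃) (v , u) c₃ * weight v u)
    ≡⟨ collect ⟩
      Σ< k (λ u → occurrences (v , u) * weight v u)
    ≤⟨ Σ<-mono-≤ k (λ u _ → ≤-trans (*-monoˡ-≤ (weight v u) (occurrences≤1 (v , u)))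
                                     (≤-reflexive (*-identityˡ (weight v u)))) ⟩
      Σ< k (weight v)
    ≡⟨ Σ<-weight v v<k ⟩
      1 + k ∎
    where
    open ≤-Reasoning
    f g h : ℕ → ℕ
    f u = indicator ((a , a) ≈ᵉ? (v , u)) * weight v u
    g u = multiplicity (edge σ₂) (v , u) c₂ * weight v u
    h u = multiplicity (edge σ₃) (v , u) c₃ * weight v u
    collect : Σ< k f + Σ< k g + Σ< k h ≡ Σ< k (λ u → occurrences (v , u) * weight v u)
    collect = sym (trans (Σ<-cong k (λ u _ → distrib u))
                         (trans (Σ<-distrib-+ k (λ u → f u + g u) h)
                                (cong (_+ Σ< k h) (Σ<-distrib-+ k f g))))
      where
      distrib : ∀ u → occurrences (v , u) * weight v u ≡ f u + g u + h u
      distrib u = trans (*-distribʳ-+ (weight v u) (l + m₂) m₃) (cong (_+ h u) (*-distribʳ-+ (weight v u) l m₂))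
        where
        l m₂ m₃ : ℕ
        l  = indicator ((a , a) ≈ᵉ? (v , u))
        m₂ = multiplicity (edge σ₂) (v , u) c₂
        m₃ = multiplicity (edge σ₃) (v , u) c₃

  degree-even : ∀ v → Σ ℕ λ m → degree v ≡ m + m
  degree-even v = δ a v + visits σ₂ c₂ v + visits σ₃ c₃ v ,
    trans (cong₂ _+_ (cong (incidence v (a , a) +_) (closedWalk-incidence σ₂ c₂ v (trans start₂ (sym end₂))))
                     (closedWalk-incidence σ₃ c₃ v (trans start₃ (sym end₃))))
          (regroup (δ a v) (visits σ₂ c₂ v) (visits σ₃ c₃ v))
    where
    regroup : ∀ x y z → (x + x) + (y + y) + (z + z) ≡ (x + y + z) + (x + y + z)
    regroup = solve-∀

  Σ<-incidence : ∀ x y → x < k → y < k → Σ< k (λ v → incidence v (x , y)) ≡ 2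
  Σ<-incidence x y x<k y<k =
    trans (Σ<-distrib-+ k (δ x) (δ y)) (cong₂ _+_ (Σ<-δ k x x<k) (Σ<-δ k y y<k))

  Σ<-walk-incidence : ∀ n σ → WalkIn k σ n → Σ< k (λ v → Σ< n (λ i → incidence v (edge σ i))) ≡ n * 2
  Σ<-walk-incidence n σ within =
    trans (sym (Σ<-comm n k (λ i v → incidence v (edge σ i))))
          (trans (Σ<-cong n (λ i i<n → Σ<-incidence (σ i) (σ (suc i)) (within (<⇒≤ i<n)) (within i<n)))
                 (Σ<-const n 2))

  handshake : Σ< k degree ≡ 2 * (1 + c₂ + c₃)
  handshake = begin
    Σ< k degree
      ≡⟨ Σ<-distrib-+ k (λ v → incidence v (a , a) + Σ< c₂ (λ i → incidence v (edge σ₂ i))) _ ⟩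
    Σ< k (λ v → incidence v (a , a) + Σ< c₂ (λ i → incidence v (edge σ₂ i)))
      + Σ< k (λ v → Σ< c₃ (λ i → incidence v (edge σ₃ i)))
      ≡⟨ cong₂ _+_ (trans (Σ<-distrib-+ k (λ v → incidence v (a , a)) _)
                          (cong₂ _+_ (Σ<-incidence a a hub<k hub<k) (Σ<-walk-incidence c₂ σ₂ within₂)))
                   (Σ<-walk-incidence c₃ σ₃ within₃) ⟩
    2 + c₂ * 2 + c₃ * 2
      ≡⟨ distrib c₂ c₃ ⟩
    2 * (1 + c₂ + c₃) ∎
    where
    open ≡-Reasoning
    distrib : ∀ x y → 2 + x * 2 + y * 2 ≡ 2 * (1 + x + y)
    distrib = solve-∀

m+m≤1+h+h⇒m+m≤h+h : ∀ m h → m + m ≤ suc (h + h) → m + m ≤ h + h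
m+m≤1+h+h⇒m+m≤h+h m h 2m≤1+2h with m ≤? h
... | yes m≤h = +-mono-≤ m≤h m≤h
... | no  m≰h = contradiction 2m≤1+2h (<⇒≱ (begin-strict
  suc (h + h)     <⟨ s≤s (≤-reflexive (sym (+-suc h h))) ⟩
  suc h + suc h   ≤⟨ +-mono-≤ (≰⇒> m≰h) (≰⇒> m≰h) ⟩
  m + m           ∎))
  where open ≤-Reasoning

hub-incidence≥2 : ∀ a σ n → 2 ≤ n → σ 0 ≡ a → σ n ≡ a → 2 ≤ Σ< n (λ i → incidence a (edge σ i))
hub-incidence≥2 a σ (suc (suc n)) _ start end =
  ≤-trans (+-mono-≤ first last) (two-terms≤Σ< (2 + n) (λ i → incidence a (edge σ i)) (s≤s z≤n) ≤-refl)
  where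
  first : 1 ≤ incidence a (edge σ 0)
  first = ≤-trans (≤-reflexive (sym (trans (cong (λ x → δ x a) start) (δ-refl a)))) (m≤m+n _ _)
  last : 1 ≤ incidence a (edge σ (suc n))
  last = ≤-trans (≤-reflexive (sym (trans (cong (λ x → δ x a) end) (δ-refl a)))) (m≤n+m _ _)
hub-incidence≥2 a σ 1 (s≤s ())

closedWalk-length≥3 : ∀ a σ n → σ 0 ≡ a → σ n ≡ a → AvoidsLoop a σ n → DistinctEdges σ n → 1 ≤ n → 3 ≤ n
closedWalk-length≥3 a σ 1 start end noLoop _ _ = ⊥-elim (noLoop (s≤s z≤n) (inj₁ (sym start , sym end)))
closedWalk-length≥3 a σ 2 start end _ distinct _
  with distinct {0} {1} (s≤s z≤n) ≤-refl (inj₂ (trans start (sym end) , refl))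
... | ()
closedWalk-length≥3 a σ (suc (suc (suc n))) _ _ _ _ _ = s≤s (s≤s (s≤s z≤n))

module Necessity {k a c₂ c₃ : ℕ} (D : Drawing k a c₂ c₃) (h : ℕ) (k≡h+h : k ≡ h + h) where
  open Drawing D
  open Degrees D

  -- Degrees are even and so is k, hence the bound 1 + k drops to k.
  degree≤k : ∀ v → v < k → degree v ≤ k
  degree≤k v v<k with degree-even v
  ... | m , deg≡m+m = subst₂ _≤_ (sym deg≡m+m) (sym k≡h+h)
    (m+m≤1+h+h⇒m+m≤h+h m h (subst₂ (λ d x → d ≤ suc x) deg≡m+m k≡h+h (degree≤1+k v v<k)))

  edge-count : 2 * (1 + c₂ + c₃) ≤ k * k
  edge-count = begin
    2 * (1 + c₂ + c₃) ≡⟨ handshake ⟨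
    Σ< k degree       ≤⟨ Σ<-mono-≤ k degree≤k ⟩
    Σ< k (λ _ → k)    ≡⟨ Σ<-const k k ⟩
    k * k             ∎
    where open ≤-Reasoning

  six≤k : 2 ≤ c₂ → 2 ≤ c₃ → 6 ≤ k
  six≤k 2≤c₂ 2≤c₃ = ≤-trans
    (+-mono-≤ (+-mono-≤ (≤-reflexive (sym (cong₂ _+_ (δ-refl a) (δ-refl a))))
                        (hub-incidence≥2 a σ₂ c₂ 2≤c₂ start₂ end₂))
              (hub-incidence≥2 a σ₃ c₃ 2≤c₃ start₃ end₃))
    (degree≤k a hub<k)

  conditions : 1 ≤ c₂ → c₂ ≤ c₃ → 6 ≤ k × 3 ≤ c₂ × 2 * (1 + c₂ + c₃) ≤ k * k
  conditions 1≤c₂ c₂≤c₃ = six≤k (≤-trans 2≤3 3≤c₂) (≤-trans 2≤3 (≤-trans 3≤c₂ c₂≤c₃)) , 3≤c₂ , edge-count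
    where
    2≤3 : 2 ≤ 3
    2≤3 = s≤s (s≤s z≤n)
    3≤c₂ : 3 ≤ c₂
    3≤c₂ = closedWalk-length≥3 a σ₂ c₂ start₂ end₂ noLoop₂ distinct₂ 1≤c₂

toPair : ∀ {k} → Fin k × Fin k → Edge
toPair (x , y) = toℕ x , toℕ y

SameEdge⇒≈ᵉ : ∀ {k} {p q : Fin k × Fin k} → SameEdge p q → toPair p ≈ᵉ toPair q
SameEdge⇒≈ᵉ (inj₁ (refl , refl)) = inj₁ (refl , refl)
SameEdge⇒≈ᵉ (inj₂ (refl , refl)) = inj₂ (refl , refl)

≈ᵉ⇒SameEdge : ∀ {k} {p q : Fin k × Fin k} → toPair p ≈ᵉ toPair q → SameEdge p q
≈ᵉ⇒SameEdge (inj₁ (x≡x' , y≡y')) = inj₁ (toℕ-injective x≡x' , toℕ-injective y≡y')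
≈ᵉ⇒SameEdge (inj₂ (x≡y' , y≡x')) = inj₂ (toℕ-injective x≡y' , toℕ-injective y≡x')

cycVert-end : ∀ {c₂ c₃} c (g : Fin (c ∸ 1) → PVert c₂ c₃) → 1 ≤ c → cycVert (c ∸ 1) g c ≡ hub
cycVert-end (suc c) g _ with c <? c
... | yes c<c = contradiction c<c (<-irrefl refl)
... | no _    = refl

module FromEmbedding {k c₂ c₃ : ℕ} (f : PVert c₂ c₃ → Fin k) (emb : IsEmbedding k c₂ c₃ f) where

  walk : ∀ {m} → (Fin m → PVert c₂ c₃) → ℕ → ℕ
  walk {m} g n = toℕ (f (cycVert m g n))

  σ₂ σ₃ : ℕ → ℕ
  σ₂ = walk in2
  σ₃ = walk in3

  -- The walks are read off along cycVert, so the j-th edge of a walk is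
  -- definitionally the image of the j-th edge of the cycle.
  module Along {c} (cycleEdge : Fin c → PEdge c₂ c₃) (σ : ℕ → ℕ)
               (image : ∀ j → toPair (imageEdge f (cycleEdge j)) ≡ edge σ (toℕ j)) where

    edge≡image : ∀ {i} (i<c : i < c) → edge σ i ≡ toPair (imageEdge f (cycleEdge (fromℕ< i<c)))
    edge≡image i<c = trans (cong (edge σ) (sym (toℕ-fromℕ< i<c))) (sym (image _))

    reflect : ∀ {i} (i<c : i < c) {e} → edge σ i ≈ᵉ toPair (imageEdge f e) → cycleEdge (fromℕ< i<c) ≡ e
    reflect i<c s = emb _ _ (≈ᵉ⇒SameEdge (subst (_≈ᵉ _) (edge≡image i<c) s))

    distinct : Injective _≡_ _≡_ cycleEdge → DistinctEdges σ c
    distinct inj {i} {j} i<c j<c s = begin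
      i                         ≡⟨ toℕ-fromℕ< i<c ⟨
      toℕ (fromℕ< i<c)          ≡⟨ cong toℕ (inj (reflect i<c (subst (_ ≈ᵉ_) (edge≡image j<c) s))) ⟩
      toℕ (fromℕ< j<c)          ≡⟨ toℕ-fromℕ< j<c ⟩
      j                         ∎
      where open ≡-Reasoning

  module A₂ = Along e2 σ₂ (λ _ → refl)
  module A₃ = Along e3 σ₃ (λ _ → refl)

  e2-injective : Injective _≡_ _≡_ (PEdge.e2 {c₂} {c₃})
  e2-injective refl = refl

  e3-injective : Injective _≡_ _≡_ (PEdge.e3 {c₂} {c₃})
  e3-injective refl = refl

  disjoint : DisjointEdges σ₂ c₂ σ₃ c₃
  disjoint i<c₂ j<c₃ s with A₂.reflect i<c₂ {e3 (fromℕ< j<c₃)} (subst (_ ≈ᵉ_) (A₃.edge≡image j<c₃) s)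
  ... | ()

  noLoop₂ : AvoidsLoop (toℕ (f hub)) σ₂ c₂
  noLoop₂ i<c₂ s with A₂.reflect i<c₂ {loop} (≈ᵉ-sym s)
  ... | ()

  noLoop₃ : AvoidsLoop (toℕ (f hub)) σ₃ c₃
  noLoop₃ i<c₃ s with A₃.reflect i<c₃ {loop} (≈ᵉ-sym s)
  ... | ()

  drawing : 1 ≤ c₂ → 1 ≤ c₃ → Drawing k (toℕ (f hub)) c₂ c₃
  drawing 1≤c₂ 1≤c₃ = record
    { σ₂ = σ₂ ; σ₃ = σ₃
    ; hub<k = toℕ<n _ ; within₂ = λ _ → toℕ<n _ ; within₃ = λ _ → toℕ<n _
    ; start₂ = refl ; end₂ = cong (toℕ ∘ f) (cycVert-end c₂ in2 1≤c₂)
    ; start₃ = refl ; end₃ = cong (toℕ ∘ f) (cycVert-end c₃ in3 1≤c₃)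
    ; distinct₂ = A₂.distinct e2-injective ; distinct₃ = A₃.distinct e3-injective
    ; disjoint = disjoint ; noLoop₂ = noLoop₂ ; noLoop₃ = noLoop₃ }

module ToEmbedding {k a c₂ c₃ : ℕ} (D : Drawing k a c₂ c₃) (1≤c₂ : 1 ≤ c₂) (1≤c₃ : 1 ≤ c₃) where
  open Drawing D

  inner : ∀ {c σ} → WalkIn k σ c → Fin (c ∸ 1) → Fin k
  inner {c} within i = fromℕ< (within (≤-trans (toℕ<n i) (m∸n≤m c 1)))

  f : PVert c₂ c₃ → Fin k
  f hub     = fromℕ< hub<k
  f (in2 i) = inner within₂ i
  f (in3 i) = inner within₃ i

  f-hub : toℕ (f hub) ≡ a
  f-hub = toℕ-fromℕ< hub<k

  cycVert-walk : ∀ {c} σ (g : Fin (c ∸ 1) → PVert c₂ c₃) → 1 ≤ c → σ 0 ≡ a → σ c ≡ a →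
    (∀ i → toℕ (f (g i)) ≡ σ (suc (toℕ i))) → ∀ n → n ≤ c → toℕ (f (cycVert (c ∸ 1) g n)) ≡ σ n
  cycVert-walk σ g _ start _ _ zero _ = trans f-hub (sym start)
  cycVert-walk {c} σ g 1≤c _ end inner≡ (suc n) n<c with n <? c ∸ 1
  ... | yes n<c-1 = trans (inner≡ _) (cong (σ ∘ suc) (toℕ-fromℕ< n<c-1))
  ... | no  n≮c-1 = trans f-hub (trans (sym end) (cong σ (sym 1+n≡c)))
    where
    1+n≡c : suc n ≡ c
    1+n≡c = ≤-antisym n<c (≤-trans (≤-reflexive (sym (m+[n∸m]≡n 1≤c))) (s≤s (≮⇒≥ n≮c-1)))

  image₂ : ∀ i → toPair (imageEdge f (e2 i)) ≡ edge σ₂ (toℕ i)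
  image₂ i = cong₂ _,_ (walk₂ (toℕ i) (<⇒≤ (toℕ<n i))) (walk₂ (suc (toℕ i)) (toℕ<n i))
    where walk₂ = cycVert-walk σ₂ in2 1≤c₂ start₂ end₂ (λ i → toℕ-fromℕ< _)

  image₃ : ∀ i → toPair (imageEdge f (e3 i)) ≡ edge σ₃ (toℕ i)
  image₃ i = cong₂ _,_ (walk₃ (toℕ i) (<⇒≤ (toℕ<n i))) (walk₃ (suc (toℕ i)) (toℕ<n i))
    where walk₃ = cycVert-walk σ₃ in3 1≤c₃ start₃ end₃ (λ i → toℕ-fromℕ< _)

  image-loop : toPair (imageEdge f (loop {c₂} {c₃})) ≡ (a , a)
  image-loop = cong₂ _,_ f-hub f-hub

  embedding : IsEmbedding k c₂ c₃ f
  embedding e e' s = reflect e e' (SameEdge⇒≈ᵉ s)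
    where
    reflect : ∀ e e' → toPair (imageEdge f e) ≈ᵉ toPair (imageEdge f e') → e ≡ e'
    reflect loop   loop   _ = refl
    reflect loop   (e2 j) s = ⊥-elim (noLoop₂ (toℕ<n j) (subst₂ _≈ᵉ_ image-loop (image₂ j) s))
    reflect loop   (e3 j) s = ⊥-elim (noLoop₃ (toℕ<n j) (subst₂ _≈ᵉ_ image-loop (image₃ j) s))
    reflect (e2 i) loop   s = ⊥-elim (noLoop₂ (toℕ<n i) (≈ᵉ-sym (subst₂ _≈ᵉ_ (image₂ i) image-loop s)))
    reflect (e3 i) loop   s = ⊥-elim (noLoop₃ (toℕ<n i) (≈ᵉ-sym (subst₂ _≈ᵉ_ (image₃ i) image-loop s)))
    reflect (e2 i) (e2 j) s = cong e2 (toℕ-injective (distinct₂ (toℕ<n i) (toℕ<n j) (subst₂ _≈ᵉ_ (image₂ i) (image₂ j) s)))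
    reflect (e3 i) (e3 j) s = cong e3 (toℕ-injective (distinct₃ (toℕ<n i) (toℕ<n j) (subst₂ _≈ᵉ_ (image₃ i) (image₃ j) s)))
    reflect (e2 i) (e3 j) s = ⊥-elim (disjoint (toℕ<n i) (toℕ<n j) (subst₂ _≈ᵉ_ (image₂ i) (image₃ j) s))
    reflect (e3 i) (e2 j) s = ⊥-elim (disjoint (toℕ<n j) (toℕ<n i) (≈ᵉ-sym (subst₂ _≈ᵉ_ (image₃ i) (image₂ j) s)))

  embeds : PetalEmbeds k c₂ c₃
  embeds = f , embedding

-- Detours

Old : ℕ → Edge → Set
Old k (x , y) = x < k × y < k

≈ᵉ-old : ∀ {k e e'} → e ≈ᵉ e' → Old k e' → Old k e
≈ᵉ-old (inj₁ (refl , refl)) old = old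
≈ᵉ-old (inj₂ (refl , refl)) (x<k , y<k) = y<k , x<k

walk-old : ∀ {k σ n i} → WalkIn k σ n → i < n → Old k (edge σ i)
walk-old within i<n = within (<⇒≤ i<n) , within i<n

data Split (d : ℕ) : ℕ → Set where
  below : ∀ {i} → i < d → Split d i
  above : ∀ j → Split d (d + j)

split : ∀ d i → Split d i
split d i with i <? d
... | yes i<d = below i<d
... | no  i≮d = subst (Split d) (m+[n∸m]≡n (≮⇒≥ i≮d)) (above (i ∸ d))

concatWalk : (ℕ → ℕ) → ℕ → (ℕ → ℕ) → ℕ → ℕ
concatWalk τ zero    σ i       = σ i
concatWalk τ (suc d) σ zero    = τ 0
concatWalk τ (suc d) σ (suc i) = concatWalk (τ ∘ suc) d σ i

concatWalk-below : ∀ d τ σ {i} → i < d → concatWalk τ d σ i ≡ τ i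
concatWalk-below (suc d) τ σ {zero}  _     = refl
concatWalk-below (suc d) τ σ {suc i} i<1+d = concatWalk-below d (τ ∘ suc) σ (s≤s⁻¹ i<1+d)

concatWalk-above : ∀ d τ σ j → concatWalk τ d σ (d + j) ≡ σ j
concatWalk-above zero    τ σ j = refl
concatWalk-above (suc d) τ σ j = concatWalk-above d (τ ∘ suc) σ j

concatWalk-start : ∀ d τ σ → τ 0 ≡ σ 0 → concatWalk τ d σ 0 ≡ σ 0
concatWalk-start zero    τ σ _     = refl
concatWalk-start (suc d) τ σ τ0≡σ0 = τ0≡σ0

concatWalk-edge-below : ∀ d τ σ {i} → τ d ≡ σ 0 → i < d → edge (concatWalk τ d σ) i ≡ edge τ i
concatWalk-edge-below d τ σ {i} τd≡σ0 i<d with m≤n⇒m<n∨m≡n i<d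
... | inj₁ 1+i<d = cong₂ _,_ (concatWalk-below d τ σ i<d) (concatWalk-below d τ σ 1+i<d)
... | inj₂ refl  = cong₂ _,_ (concatWalk-below d τ σ i<d)
                             (trans (concatWalk-at-end d τ σ) (sym τd≡σ0))
  where
  concatWalk-at-end : ∀ d τ σ → concatWalk τ d σ d ≡ σ 0
  concatWalk-at-end zero    τ σ = refl
  concatWalk-at-end (suc d) τ σ = concatWalk-at-end d (τ ∘ suc) σ

concatWalk-edge-above : ∀ d τ σ j → edge (concatWalk τ d σ) (d + j) ≡ edge σ j
concatWalk-edge-above d τ σ j =
  cong₂ _,_ (concatWalk-above d τ σ j)
            (trans (cong (concatWalk τ d σ) (sym (+-suc d j))) (concatWalk-above d τ σ (suc j)))

-- A closed walk at the hub 0 in K_{k+2}^* every edge of which meets one of the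
-- two new vertices k, k + 1.
record Detour (k d : ℕ) : Set where
  field
    walk     : ℕ → ℕ
    start    : walk 0 ≡ 0
    end      : walk d ≡ 0
    within   : WalkIn (2 + k) walk d
    distinct : DistinctEdges walk d
    fresh    : ∀ {i} → i < d → ¬ Old k (edge walk i)

splice : ∀ {k c₂ c₃ d} → Drawing k 0 c₂ c₃ → Detour k d → Drawing (2 + k) 0 c₂ (d + c₃)
splice {k} {c₂} {c₃} {d} D detour = record
  { σ₂ = σ₂ ; σ₃ = σ
  ; hub<k = <-≤-trans hub<k k≤2+k
  ; within₂ = λ i≤c₂ → <-≤-trans (within₂ i≤c₂) k≤2+k
  ; within₃ = within-σ
  ; start₂ = start₂ ; end₂ = end₂
  ; start₃ = start-σ
  ; end₃ = trans (concatWalk-above d walk σ₃ c₃) end₃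
  ; distinct₂ = distinct₂ ; distinct₃ = distinct-σ
  ; disjoint = disjoint-σ
  ; noLoop₂ = noLoop₂ ; noLoop₃ = noLoop-σ }
  where
  open Drawing D
  open Detour detour renaming (start to startᵀ; end to endᵀ; within to withinᵀ; distinct to distinctᵀ)

  σ : ℕ → ℕ
  σ = concatWalk walk d σ₃

  k≤2+k : k ≤ 2 + k
  k≤2+k = m≤n+m k 2

  joins : walk d ≡ σ₃ 0
  joins = trans endᵀ (sym start₃)

  edge-below : ∀ {i} → i < d → edge σ i ≡ edge walk i
  edge-below = concatWalk-edge-below d walk σ₃ joins

  edge-above : ∀ j → edge σ (d + j) ≡ edge σ₃ j
  edge-above = concatWalk-edge-above d walk σ₃

  start-σ : σ 0 ≡ 0
  start-σ = trans (concatWalk-start d walk σ₃ (trans startᵀ (sym start₃))) start₃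

  within-σ : WalkIn (2 + k) σ (d + c₃)
  within-σ {i} i≤d+c₃ with split d i
  ... | below i<d = subst (_< 2 + k) (sym (concatWalk-below d walk σ₃ i<d)) (withinᵀ (<⇒≤ i<d))
  ... | above j   = subst (_< 2 + k) (sym (concatWalk-above d walk σ₃ j))
                          (<-≤-trans (within₃ (+-cancelˡ-≤ d _ _ i≤d+c₃)) k≤2+k)

  fresh≉old : ∀ {i e} → i < d → Old k e → ¬ edge σ i ≈ᵉ e
  fresh≉old i<d old s = fresh i<d (≈ᵉ-old (subst (_≈ᵉ _) (edge-below i<d) s) old)

  distinct-σ : DistinctEdges σ (d + c₃)
  distinct-σ {i} {j} i<n j<n s with split d i | split d j
  ... | below i<d | below j<d = distinctᵀ i<d j<d (subst₂ _≈ᵉ_ (edge-below i<d) (edge-below j<d) s)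
  ... | below i<d | above j'  = ⊥-elim (fresh≉old i<d (walk-old within₃ (+-cancelˡ-< d _ _ j<n))
                                                    (subst (_ ≈ᵉ_) (edge-above j') s))
  ... | above i'  | below j<d = ⊥-elim (fresh≉old j<d (walk-old within₃ (+-cancelˡ-< d _ _ i<n))
                                                    (subst (_ ≈ᵉ_) (edge-above i') (≈ᵉ-sym s)))
  ... | above i'  | above j'  = cong (d +_) (distinct₃ (+-cancelˡ-< d _ _ i<n) (+-cancelˡ-< d _ _ j<n)
                                                      (subst₂ _≈ᵉ_ (edge-above i') (edge-above j') s))

  disjoint-σ : DisjointEdges σ₂ c₂ σ (d + c₃)
  disjoint-σ {i} {j} i<c₂ j<n s with split d j
  ... | below j<d = fresh≉old j<d (walk-old within₂ i<c₂) (≈ᵉ-sym s)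
  ... | above j'  = disjoint i<c₂ (+-cancelˡ-< d _ _ j<n) (subst (_ ≈ᵉ_) (edge-above j') s)

  noLoop-σ : AvoidsLoop 0 σ (d + c₃)
  noLoop-σ {i} i<n s with split d i
  ... | below i<d = fresh≉old i<d (hub<k , hub<k) (≈ᵉ-sym s)
  ... | above j   = noLoop₃ (+-cancelˡ-< d _ _ i<n) (subst (_ ≈ᵉ_) (edge-above j) s)

data NewVertex : Set where
  x₀ x₁ : NewVertex

-- K_{k+2}^* as K_k^* extended by the new vertices x₀ = k and x₁ = k + 1.
module Extension (k : ℕ) where

  vertex : NewVertex → ℕ
  vertex x₀ = k
  vertex x₁ = suc k

  k≤vertex : ∀ n → k ≤ vertex n
  k≤vertex x₀ = ≤-refl
  k≤vertex x₁ = n≤1+n k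

  vertex-injective : ∀ {n n'} → vertex n ≡ vertex n' → n ≡ n'
  vertex-injective {x₀} {x₀} _ = refl
  vertex-injective {x₁} {x₁} _ = refl
  vertex-injective {x₀} {x₁} k≡1+k = contradiction (sym k≡1+k) (1+n≢n)
  vertex-injective {x₁} {x₀} 1+k≡k = contradiction 1+k≡k (1+n≢n)

  -- The edges of K_{k+2}^* that are not edges of K_k^*, named by their old
  -- endpoint and their new endpoint (spokes), or by their vertex (loops).
  data Label : Set where
    spoke  : ℕ → NewVertex → Label
    loopAt : NewVertex → Label

  toEdge : Label → Edge
  toEdge (spoke o n) = o , vertex n
  toEdge (loopAt n)  = vertex n , vertex n

  Valid : Label → Set
  Valid (spoke o _) = o < k
  Valid (loopAt _)  = ⊤

  Labels : Label → Edge → Set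
  Labels l e = Valid l × e ≈ᵉ toEdge l

  ≈ᵉ-loop : ∀ {a b c} → (a , b) ≈ᵉ (c , c) → a ≡ c
  ≈ᵉ-loop (inj₁ (a≡c , _)) = a≡c
  ≈ᵉ-loop (inj₂ (a≡c , _)) = a≡c

  toEdge-injective : ∀ {l l'} → Valid l → Valid l' → toEdge l ≈ᵉ toEdge l' → l ≡ l'
  toEdge-injective {spoke o n}  {spoke o' n'} _   _ (inj₁ (refl , n≡n')) = cong (spoke o) (vertex-injective n≡n')
  toEdge-injective {spoke o n}  {spoke o' n'} o<k _ (inj₂ (refl , _))   = contradiction (k≤vertex n') (<⇒≱ o<k)
  toEdge-injective {spoke o n}  {loopAt n'}   o<k _ s =
    contradiction (subst (k ≤_) (sym (≈ᵉ-loop s)) (k≤vertex n')) (<⇒≱ o<k)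
  toEdge-injective {loopAt n}   {spoke o' n'} _ o'<k s =
    contradiction (subst (k ≤_) (sym (≈ᵉ-loop (≈ᵉ-sym s))) (k≤vertex n)) (<⇒≱ o'<k)
  toEdge-injective {loopAt n}   {loopAt n'}   _ _ s = cong loopAt (vertex-injective (≈ᵉ-loop s))

  labels-≈ : ∀ {l l' e e'} → Labels l e → Labels l' e' → e ≈ᵉ e' → l ≡ l'
  labels-≈ (v , e≈l) (v' , e'≈l') e≈e' = toEdge-injective v v' (≈ᵉ-trans (≈ᵉ-sym e≈l) (≈ᵉ-trans e≈e' e'≈l'))

  labels⇒new : ∀ {l e} → Labels l e → ¬ Old k e
  labels⇒new {spoke o n} (_ , e≈l) old = <⇒≱ (proj₂ (≈ᵉ-old (≈ᵉ-sym e≈l) old)) (k≤vertex n)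
  labels⇒new {loopAt n}  (_ , e≈l) old = <⇒≱ (proj₁ (≈ᵉ-old (≈ᵉ-sym e≈l) old)) (k≤vertex n)

  vertex<2+k : ∀ n → vertex n < 2 + k
  vertex<2+k x₀ = ≤-trans (n<1+n k) (n≤1+n _)
  vertex<2+k x₁ = n<1+n (suc k)

  labels⇒old : ∀ {l e} → Labels l e → Old (2 + k) e
  labels⇒old {spoke o n} (o<k , e≈l) = ≈ᵉ-old e≈l (≤-trans o<k (m≤n+m k 2) , vertex<2+k n)
  labels⇒old {loopAt n}  (_ , e≈l)   = ≈ᵉ-old e≈l (vertex<2+k n , vertex<2+k n)

  record Labelling (walk : ℕ → ℕ) (d : ℕ) : Set where
    field
      label     : ℕ → Label
      labels    : ∀ {i} → i < d → Labels (label i) (edge walk i)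
      injective : ∀ {i j} → i < d → j < d → label i ≡ label j → i ≡ j

  labelled-detour : ∀ {walk d} → walk 0 ≡ 0 → walk d ≡ 0 → Labelling walk d → Detour k d
  labelled-detour {walk} {d} start end L = record
    { walk = walk ; start = start ; end = end
    ; within = within
    ; distinct = λ i<d j<d s → injective i<d j<d (labels-≈ (labels i<d) (labels j<d) s)
    ; fresh = λ i<d → labels⇒new (labels i<d) }
    where
    open Labelling L
    within : WalkIn (2 + k) walk d
    within i≤d with m≤n⇒m<n∨m≡n i≤d
    ... | inj₁ i<d  = proj₁ (labels⇒old (labels i<d))
    ... | inj₂ refl = subst (_< 2 + k) (sym end) z<s

  -- chain t b visits 2b, x₀, 2b+1, x₁, 2b+2, x₀, …, 2b+2t-1, x₁ and returns to 0.
  chain : ℕ → ℕ → ℕ → ℕ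
  chain zero    b _ = 0
  chain (suc t) b 0 = b + b
  chain (suc t) b 1 = k
  chain (suc t) b 2 = suc (b + b)
  chain (suc t) b 3 = suc k
  chain (suc t) b (suc (suc (suc (suc i)))) = chain t (suc b) i

  chainLabel : ℕ → ℕ → ℕ → Label
  chainLabel zero    b _ = loopAt x₀
  chainLabel (suc t) b 0 = spoke (b + b) x₀
  chainLabel (suc t) b 1 = spoke (suc (b + b)) x₀
  chainLabel (suc t) b 2 = spoke (suc (b + b)) x₁
  chainLabel (suc t) b 3 = spoke (chain t (suc b) 0) x₁
  chainLabel (suc t) b (suc (suc (suc (suc i)))) = chainLabel t (suc b) i

  chain-start : ∀ t → chain t 0 0 ≡ 0
  chain-start zero    = refl
  chain-start (suc t) = refl

  chain-end : ∀ t b → chain t b (t * 4) ≡ 0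
  chain-end zero    b = refl
  chain-end (suc t) b = chain-end t (suc b)

  fits-next : ∀ b t → b + b + (suc t + suc t) ≤ k → suc b + suc b + (t + t) ≤ k
  fits-next b t = subst (_≤ k) (shift b t)
    where
    shift : ∀ b t → b + b + (suc t + suc t) ≡ suc b + suc b + (t + t)
    shift = solve-∀

  block-fits : ∀ b t → b + b + (suc t + suc t) ≤ k → suc (b + b) < k
  block-fits b t fits = ≤-trans (s≤s (s≤s (m≤m+n (b + b) (t + t)))) (subst (_≤ k) (shift b t) fits)
    where
    shift : ∀ b t → b + b + (suc t + suc t) ≡ suc (suc (b + b + (t + t)))
    shift = solve-∀

  next-fits : ∀ b t → b + b + (suc t + suc t) ≤ k → chain t (suc b) 0 < k
  next-fits b zero     fits = ≤-trans (s≤s z≤n) (block-fits b 0 fits)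
  next-fits b (suc t) fits = ≤-trans (s≤s (m≤m+n (suc b + suc b) (t + t + 1))) (subst (_≤ k) (shift b t) fits)
    where
    shift : ∀ b t → b + b + (suc (suc t) + suc (suc t)) ≡ suc (suc b + suc b + (t + t + 1))
    shift = solve-∀

  chain-labels : ∀ t b {i} → b + b + (t + t) ≤ k → i < t * 4 → Labels (chainLabel t b i) (edge (chain t b) i)
  chain-labels (suc t) b {0} fits _ = ≤-trans (n≤1+n _) (block-fits b t fits) , inj₁ (refl , refl)
  chain-labels (suc t) b {1} fits _ = block-fits b t fits , inj₂ (refl , refl)
  chain-labels (suc t) b {2} fits _ = block-fits b t fits , inj₁ (refl , refl)
  chain-labels (suc t) b {3} fits _ = next-fits b t fits , inj₂ (refl , refl)
  chain-labels (suc t) b {suc (suc (suc (suc i)))} fits i<n =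
    chain-labels t (suc b) (fits-next b t fits) (+-cancelˡ-< 4 _ _ i<n)

  -- Labels of edges from block b onwards of a chain.
  Later : ℕ → Label → Set
  Later b (spoke o x₀) = b + b ≤ o
  Later b (spoke o x₁) = suc (b + b) ≤ o ⊎ o ≡ 0
  Later b (loopAt _)   = ⊥

  [1+b]+[1+b]≡2+[b+b] : ∀ b → suc b + suc b ≡ suc (suc (b + b))
  [1+b]+[1+b]≡2+[b+b] b = cong suc (+-suc b b)

  later-weaken : ∀ b l → Later (suc b) l → Later b l
  later-weaken b (spoke o x₀) later = ≤-trans (≤-trans (n≤1+n _) (n≤1+n _)) (subst (_≤ o) ([1+b]+[1+b]≡2+[b+b] b) later)
  later-weaken b (spoke o x₁) (inj₁ later) =
    inj₁ (≤-trans (s≤s (≤-trans (n≤1+n _) (n≤1+n _))) (subst (λ m → suc m ≤ o) ([1+b]+[1+b]≡2+[b+b] b) later))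
  later-weaken b (spoke o x₁) (inj₂ o≡0) = inj₂ o≡0

  next-later : ∀ t b → suc (b + b) ≤ chain t (suc b) 0 ⊎ chain t (suc b) 0 ≡ 0
  next-later zero    b = inj₂ refl
  next-later (suc t) b = inj₁ (subst (suc (b + b) ≤_) (sym ([1+b]+[1+b]≡2+[b+b] b)) (n≤1+n _))

  chainLabel-later : ∀ t b {i} → i < t * 4 → Later b (chainLabel t b i)
  chainLabel-later (suc t) b {0} _ = ≤-refl
  chainLabel-later (suc t) b {1} _ = n≤1+n _
  chainLabel-later (suc t) b {2} _ = inj₁ ≤-refl
  chainLabel-later (suc t) b {3} _ = next-later t b
  chainLabel-later (suc t) b {suc (suc (suc (suc i)))} i<n =
    later-weaken b _ (chainLabel-later t (suc b) (+-cancelˡ-< 4 _ _ i<n))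

  position : ℕ → Label → ℕ
  position b (spoke o x₀) = if does (o ≟ b + b) then 0 else 1
  position b (spoke o x₁) = if does (o ≟ suc (b + b)) then 2 else 3
  position b (loopAt _)   = 0

  position-chainLabel : ∀ t b {r} → r < 4 → position b (chainLabel (suc t) b r) ≡ r
  position-chainLabel t b {0} _ = cong (if_then 0 else 1) (dec-true (b + b ≟ b + b) refl)
  position-chainLabel t b {1} _ = cong (if_then 0 else 1) (dec-false (suc (b + b) ≟ b + b) 1+n≢n)
  position-chainLabel t b {2} _ = cong (if_then 2 else 3) (dec-true (suc (b + b) ≟ suc (b + b)) refl)
  position-chainLabel t b {3} _ = cong (if_then 2 else 3) (dec-false (chain t (suc b) 0 ≟ suc (b + b)) (next≢ t))
    where
    next≢ : ∀ t → chain t (suc b) 0 ≢ suc (b + b)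
    next≢ zero    ()
    next≢ (suc t) eq = 1+n≢n (trans (sym ([1+b]+[1+b]≡2+[b+b] b)) eq)
  position-chainLabel t b {suc (suc (suc (suc _)))} (s≤s (s≤s (s≤s (s≤s ()))))

  firstBlock-not-later : ∀ t b {r} → r < 4 → ¬ Later (suc b) (chainLabel (suc (suc t)) b r)
  firstBlock-not-later t b {0} _ later = <⇒≱ (≤-trans (n<1+n _) (n≤1+n _)) (subst (_≤ b + b) ([1+b]+[1+b]≡2+[b+b] b) later)
  firstBlock-not-later t b {1} _ later = <⇒≱ (n<1+n _) (subst (_≤ suc (b + b)) ([1+b]+[1+b]≡2+[b+b] b) later)
  firstBlock-not-later t b {2} _ (inj₁ later) =
    <⇒≱ (≤-trans (n<1+n _) (n≤1+n _)) (s≤s⁻¹ (subst (λ m → suc m ≤ suc (b + b)) ([1+b]+[1+b]≡2+[b+b] b) later))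
  firstBlock-not-later t b {3} _ (inj₁ later) = <-irrefl refl later
  firstBlock-not-later t b {suc (suc (suc (suc _)))} (s≤s (s≤s (s≤s (s≤s ()))))

  firstBlock≢later : ∀ t b {r j} → r < 4 → j < t * 4 → chainLabel (suc t) b r ≢ chainLabel t (suc b) j
  firstBlock≢later (suc t) b r<4 j<n eq =
    firstBlock-not-later t b r<4 (subst (Later (suc b)) (sym eq) (chainLabel-later (suc t) (suc b) j<n))

  chainLabel-injective : ∀ t b {i j} → i < t * 4 → j < t * 4 → chainLabel t b i ≡ chainLabel t b j → i ≡ j
  chainLabel-injective (suc t) b {i} {j} i<n j<n eq with split 4 i | split 4 j
  ... | below i<4 | below j<4 =
    trans (sym (position-chainLabel t b i<4)) (trans (cong (position b) eq) (position-chainLabel t b j<4))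
  ... | below i<4 | above _   = ⊥-elim (firstBlock≢later t b i<4 (+-cancelˡ-< 4 _ _ j<n) eq)
  ... | above _   | below j<4 = ⊥-elim (firstBlock≢later t b j<4 (+-cancelˡ-< 4 _ _ i<n) (sym eq))
  ... | above _   | above _   =
    cong (4 +_) (chainLabel-injective t (suc b) (+-cancelˡ-< 4 _ _ i<n) (+-cancelˡ-< 4 _ _ j<n) eq)

  chainDetour : ∀ t → t + t ≤ k → Detour k (t * 4)
  chainDetour t fits = labelled-detour (chain-start t) (chain-end t 0) record
    { label     = chainLabel t 0
    ; labels    = chain-labels t 0 fits
    ; injective = chainLabel-injective t 0 }


  -- 0, x₀, x₀, 1, x₁, x₁ followed by the chain from block 1; for k = 2g + 2 it
  -- uses every edge of K_{k+2}^* at x₀ or x₁ except x₀x₁.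
  fullWalk : ℕ → ℕ → ℕ
  fullWalk g 0 = 0
  fullWalk g 1 = k
  fullWalk g 2 = k
  fullWalk g 3 = 1
  fullWalk g 4 = suc k
  fullWalk g 5 = suc k
  fullWalk g (suc (suc (suc (suc (suc (suc i)))))) = chain g 1 i

  fullLabel : ℕ → ℕ → Label
  fullLabel g 0 = spoke 0 x₀
  fullLabel g 1 = loopAt x₀
  fullLabel g 2 = spoke 1 x₀
  fullLabel g 3 = spoke 1 x₁
  fullLabel g 4 = loopAt x₁
  fullLabel g 5 = spoke (chain g 1 0) x₁
  fullLabel g (suc (suc (suc (suc (suc (suc i)))))) = chainLabel g 1 i

  full-labels : ∀ g {i} → 1 + 1 + (g + g) ≤ k → i < 6 + g * 4 → Labels (fullLabel g i) (edge (fullWalk g) i)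
  full-labels g {0} fits _ = ≤-trans (s≤s z≤n) fits , inj₁ (refl , refl)
  full-labels g {1} fits _ = tt , inj₁ (refl , refl)
  full-labels g {2} fits _ = ≤-trans (s≤s (s≤s z≤n)) fits , inj₂ (refl , refl)
  full-labels g {3} fits _ = ≤-trans (s≤s (s≤s z≤n)) fits , inj₁ (refl , refl)
  full-labels g {4} fits _ = tt , inj₁ (refl , refl)
  full-labels g {5} fits _ = next-fits 0 g (subst (_≤ k) (cong suc (sym (+-suc g g))) fits) , inj₂ (refl , refl)
  full-labels g {suc (suc (suc (suc (suc (suc i)))))} fits i<n = chain-labels g 1 fits (+-cancelˡ-< 6 _ _ i<n)

  prefixPosition : Label → ℕ
  prefixPosition (spoke zero x₀)    = 0
  prefixPosition (loopAt x₀)        = 1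
  prefixPosition (spoke (suc _) x₀) = 2
  prefixPosition (spoke 1 x₁)       = 3
  prefixPosition (loopAt x₁)        = 4
  prefixPosition (spoke _ x₁)       = 5

  prefixPosition-fullLabel : ∀ g {r} → r < 6 → prefixPosition (fullLabel g r) ≡ r
  prefixPosition-fullLabel g       {0} _ = refl
  prefixPosition-fullLabel g       {1} _ = refl
  prefixPosition-fullLabel g       {2} _ = refl
  prefixPosition-fullLabel g       {3} _ = refl
  prefixPosition-fullLabel g       {4} _ = refl
  prefixPosition-fullLabel zero    {5} _ = refl
  prefixPosition-fullLabel (suc g) {5} _ = refl
  prefixPosition-fullLabel g {suc (suc (suc (suc (suc (suc _)))))} (s≤s (s≤s (s≤s (s≤s (s≤s (s≤s ()))))))

  prefix-not-later : ∀ g {r} → r < 6 → ¬ Later 1 (fullLabel (suc g) r)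
  prefix-not-later g {0} _ ()
  prefix-not-later g {1} _ ()
  prefix-not-later g {2} _ (s≤s ())
  prefix-not-later g {3} _ (inj₁ (s≤s ()))
  prefix-not-later g {3} _ (inj₂ ())
  prefix-not-later g {4} _ ()
  prefix-not-later g {5} _ (inj₁ (s≤s (s≤s ())))
  prefix-not-later g {5} _ (inj₂ ())
  prefix-not-later g {suc (suc (suc (suc (suc (suc _)))))} (s≤s (s≤s (s≤s (s≤s (s≤s (s≤s ()))))))

  prefix≢later : ∀ g {r j} → r < 6 → j < g * 4 → fullLabel g r ≢ chainLabel g 1 j
  prefix≢later (suc g) r<6 j<n eq =
    prefix-not-later g r<6 (subst (Later 1) (sym eq) (chainLabel-later (suc g) 1 j<n))

  fullLabel-injective : ∀ g {i j} → i < 6 + g * 4 → j < 6 + g * 4 → fullLabel g i ≡ fullLabel g j → i ≡ j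
  fullLabel-injective g {i} {j} i<n j<n eq with split 6 i | split 6 j
  ... | below i<6 | below j<6 =
    trans (sym (prefixPosition-fullLabel g i<6)) (trans (cong prefixPosition eq) (prefixPosition-fullLabel g j<6))
  ... | below i<6 | above _   = ⊥-elim (prefix≢later g i<6 (+-cancelˡ-< 6 _ _ j<n) eq)
  ... | above _   | below j<6 = ⊥-elim (prefix≢later g j<6 (+-cancelˡ-< 6 _ _ i<n) (sym eq))
  ... | above _   | above _   =
    cong (6 +_) (chainLabel-injective g 1 (+-cancelˡ-< 6 _ _ i<n) (+-cancelˡ-< 6 _ _ j<n) eq)

  fullDetour : ∀ g → 1 + 1 + (g + g) ≤ k → Detour k (6 + g * 4)
  fullDetour g fits = labelled-detour refl (chain-end g 1) record
    { label     = fullLabel g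
    ; labels    = full-labels g fits
    ; injective = fullLabel-injective g }

-- Induction on k

swap : ∀ {k a c₂ c₃} → Drawing k a c₂ c₃ → Drawing k a c₃ c₂
swap D = record
  { σ₂ = σ₃ ; σ₃ = σ₂ ; hub<k = hub<k ; within₂ = within₃ ; within₃ = within₂
  ; start₂ = start₃ ; end₂ = end₃ ; start₃ = start₂ ; end₃ = end₂
  ; distinct₂ = distinct₃ ; distinct₃ = distinct₂
  ; disjoint = λ i<c₃ j<c₂ s → disjoint j<c₂ i<c₃ (≈ᵉ-sym s)
  ; noLoop₂ = noLoop₃ ; noLoop₃ = noLoop₂ }
  where open Drawing D

widen : ∀ {k k' a c₂ c₃} → k ≤ k' → Drawing k a c₂ c₃ → Drawing k' a c₂ c₃
widen k≤k' D = record
  { σ₂ = σ₂ ; σ₃ = σ₃ ; hub<k = <-≤-trans hub<k k≤k'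
  ; within₂ = λ i≤c₂ → <-≤-trans (within₂ i≤c₂) k≤k' ; within₃ = λ i≤c₃ → <-≤-trans (within₃ i≤c₃) k≤k'
  ; start₂ = start₂ ; end₂ = end₂ ; start₃ = start₃ ; end₃ = end₃
  ; distinct₂ = distinct₂ ; distinct₃ = distinct₃ ; disjoint = disjoint
  ; noLoop₂ = noLoop₂ ; noLoop₃ = noLoop₃ }
  where open Drawing D

Constructible : ℕ → ℕ → Set
Constructible k B = ∀ c₂ c₃ → 3 ≤ c₂ → 3 ≤ c₃ → 1 + c₂ + c₃ ≤ B → Drawing k 0 c₂ c₃

OrderedConstructible : ℕ → ℕ → Set
OrderedConstructible k B = ∀ c₂ c₃ → 3 ≤ c₂ → c₂ ≤ c₃ → 1 + c₂ + c₃ ≤ B → Drawing k 0 c₂ c₃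

ordered⇒constructible : ∀ {k B} → OrderedConstructible k B → Constructible k B
ordered⇒constructible {k} {B} construct c₂ c₃ 3≤c₂ 3≤c₃ bound with ≤-total c₂ c₃
... | inj₁ c₂≤c₃ = construct c₂ c₃ 3≤c₂ c₂≤c₃ bound
... | inj₂ c₃≤c₂ = swap (construct c₃ c₂ 3≤c₃ c₃≤c₂ (subst (λ n → suc n ≤ B) (+-comm c₂ c₃) bound))

splice-into : ∀ {k B c₂ c₃} d → Constructible k B → Detour k d →
  3 ≤ c₂ → d + 3 ≤ c₃ → 1 + c₂ + c₃ ≤ B + d → Drawing (2 + k) 0 c₂ c₃
splice-into {k} {B} {c₂} {c₃} d construct detour 3≤c₂ d+3≤c₃ bound =
  subst (Drawing (2 + k) 0 c₂) d+c₃'≡c₃ (splice (construct c₂ c₃' 3≤c₂ 3≤c₃' bound') detour)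
  where
  c₃' : ℕ
  c₃' = c₃ ∸ d
  d+c₃'≡c₃ : d + c₃' ≡ c₃
  d+c₃'≡c₃ = m+[n∸m]≡n (≤-trans (m≤m+n d 3) d+3≤c₃)
  3≤c₃' : 3 ≤ c₃'
  3≤c₃' = +-cancelˡ-≤ d 3 c₃' (subst (d + 3 ≤_) (sym d+c₃'≡c₃) d+3≤c₃)
  bound' : 1 + c₂ + c₃' ≤ B
  bound' = +-cancelʳ-≤ d _ B (subst (_≤ B + d) (shift c₂ c₃' d) (subst (λ c → 1 + c₂ + c ≤ B + d) (sym d+c₃'≡c₃) bound))
    where
    shift : ∀ c₂ c₃' d → 1 + c₂ + (d + c₃') ≡ 1 + c₂ + c₃' + d
    shift = solve-∀

round-up-to-4 : ∀ e → Σ ℕ λ t → e ≤ t * 4 × t * 4 ≤ e + 3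
round-up-to-4 zero = 0 , z≤n , z≤n
round-up-to-4 (suc e) with round-up-to-4 e
... | t , e≤4t , 4t≤e+3 with m≤n⇒m<n∨m≡n e≤4t
...   | inj₁ e<4t = t , e<4t , ≤-trans 4t≤e+3 (n≤1+n (e + 3))
...   | inj₂ refl = suc t , s≤s (m≤n+m (t * 4) 3) , ≤-reflexive (trans (+-comm 4 (t * 4)) (+-suc (t * 4) 3))

chain-length : ∀ g B c₂ c₃ → g * 4 + 15 ≤ B → c₂ ≤ c₃ → c₃ ≤ g * 4 + 8 → B ≤ 1 + c₂ + c₃ →
  Σ ℕ λ t → t + t ≤ suc g + suc g × t * 4 + 3 ≤ c₃ × 1 + c₂ + c₃ ≤ B + t * 4
chain-length g B c₂ c₃ room c₂≤c₃ short B≤n = t , t+t≤k , 4t+3≤c₃ , n≤B+4t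
  where
  open ≤-Reasoning
  e : ℕ
  e = 1 + c₂ + c₃ ∸ B
  B+e≡n : B + e ≡ 1 + c₂ + c₃
  B+e≡n = m+[n∸m]≡n B≤n
  t : ℕ
  t = proj₁ (round-up-to-4 e)
  e≤4t : e ≤ t * 4
  e≤4t = proj₁ (proj₂ (round-up-to-4 e))
  4t≤e+3 : t * 4 ≤ e + 3
  4t≤e+3 = proj₂ (proj₂ (round-up-to-4 e))

  n≤B+4t : 1 + c₂ + c₃ ≤ B + t * 4
  n≤B+4t = subst (_≤ B + t * 4) B+e≡n (+-monoʳ-≤ B e≤4t)

  c₂+7≤B : c₂ + 7 ≤ B
  c₂+7≤B = ≤-trans (+-monoˡ-≤ 7 (≤-trans c₂≤c₃ short)) (≤-trans (≤-reflexive (eq g)) room)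
    where
    eq : ∀ g → g * 4 + 8 + 7 ≡ g * 4 + 15
    eq = solve-∀

  4t+3≤c₃ : t * 4 + 3 ≤ c₃
  4t+3≤c₃ = +-cancelʳ-≤ B _ _ (begin
    t * 4 + 3 + B   ≤⟨ +-monoˡ-≤ B (+-monoˡ-≤ 3 4t≤e+3) ⟩
    e + 3 + 3 + B   ≡⟨ regroup e B ⟩
    B + e + 6       ≡⟨ cong (_+ 6) B+e≡n ⟩
    1 + c₂ + c₃ + 6 ≡⟨ regroup′ c₂ c₃ ⟩
    c₂ + 7 + c₃     ≤⟨ +-monoˡ-≤ c₃ c₂+7≤B ⟩
    B + c₃          ≡⟨ +-comm B c₃ ⟩
    c₃ + B          ∎)
    where
    regroup : ∀ e B → e + 3 + 3 + B ≡ B + e + 6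
    regroup = solve-∀
    regroup′ : ∀ c₂ c₃ → 1 + c₂ + c₃ + 6 ≡ c₂ + 7 + c₃
    regroup′ = solve-∀

  t≤1+g : t ≤ suc g
  t≤1+g = s≤s⁻¹ (*-cancelʳ-< 4 t (suc (suc g)) (begin-strict
    t * 4           <⟨ m<m+n (t * 4) z<s ⟩
    t * 4 + 3       ≤⟨ ≤-trans 4t+3≤c₃ short ⟩
    g * 4 + 8       ≡⟨ +-comm (g * 4) 8 ⟩
    suc (suc g) * 4 ∎))

  t+t≤k : t + t ≤ suc g + suc g
  t+t≤k = +-mono-≤ t≤1+g t≤1+g

splice-chain : ∀ g B c₂ c₃ → g * 4 + 15 ≤ B → Constructible (suc g + suc g) B → 3 ≤ c₂ → c₂ ≤ c₃ →
  c₃ ≤ g * 4 + 8 → B ≤ 1 + c₂ + c₃ → Drawing (2 + (suc g + suc g)) 0 c₂ c₃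
splice-chain g B c₂ c₃ room construct 3≤c₂ c₂≤c₃ short B≤n =
  let t , t+t≤k , 4t+3≤c₃ , n≤B+4t = chain-length g B c₂ c₃ room c₂≤c₃ short B≤n
  in splice-into (t * 4) construct (Extension.chainDetour _ t t+t≤k) 3≤c₂ 4t+3≤c₃ n≤B+4t

extend : ∀ g B → g * 4 + 15 ≤ B → Constructible (suc g + suc g) B →
         Constructible (2 + (suc g + suc g)) (B + (6 + g * 4))
extend g B room construct = ordered⇒constructible extend-ordered
  where
  k : ℕ
  k = suc g + suc g

  extend-ordered : OrderedConstructible (2 + k) (B + (6 + g * 4))
  extend-ordered c₂ c₃ 3≤c₂ c₂≤c₃ bound with 1 + c₂ + c₃ ≤? B | 6 + g * 4 + 3 ≤? c₃
  ... | yes fits | _ = widen (m≤n+m k 2) (construct c₂ c₃ 3≤c₂ (≤-trans 3≤c₂ c₂≤c₃) fits)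
  ... | no _ | yes long =
    splice-into (6 + g * 4) construct (Extension.fullDetour k g (≤-reflexive (cong suc (sym (+-suc g g))))) 3≤c₂ long bound
  ... | no too-many | no ¬long =
    splice-chain g B c₂ c₃ room construct 3≤c₂ c₂≤c₃ short (<⇒≤ (≰⇒> too-many))
    where
    short : c₃ ≤ g * 4 + 8
    short = ≤-trans (s≤s⁻¹ (≰⇒> ¬long)) (≤-reflexive (eq g))
      where
      eq : ∀ g → 5 + g * 4 + 3 ≡ g * 4 + 8
      eq = solve-∀

-- The cases k = 6 and k = 8 by computation

nth : {A : Set} → A → List A → ℕ → A
nth d []       _       = d
nth d (x ∷ xs) zero    = x
nth d (x ∷ xs) (suc n) = nth d xs n

all-nth : ∀ {A : Set} (p : A → Bool) d xs {i} → T (all p xs) → i < length xs → T (p (nth d xs i))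
all-nth p d (x ∷ xs) {zero}  holds _     = proj₁ (to T-∧ holds)
all-nth p d (x ∷ xs) {suc i} holds i<len = all-nth p d xs (proj₂ (to T-∧ holds)) (s≤s⁻¹ i<len)

nth-beyond : ∀ {A : Set} (d : A) xs {i} → length xs ≤ i → nth d xs i ≡ d
nth-beyond d []       _   = refl
nth-beyond d (x ∷ xs) {suc i} len≤1+i = nth-beyond d xs (s≤s⁻¹ len≤1+i)

edgeList : List ℕ → List Edge
edgeList (a ∷ b ∷ r) = (a , b) ∷ edgeList (b ∷ r)
edgeList _           = []

edgeList-nth : ∀ w {i} → suc i < length w → nth (0 , 0) (edgeList w) i ≡ edge (nth 0 w) i
edgeList-nth (a ∷ b ∷ r) {zero}  _     = refl
edgeList-nth (a ∷ b ∷ r) {suc i} i<len = edgeList-nth (b ∷ r) (s≤s⁻¹ i<len)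
edgeList-nth (a ∷ [])    (s≤s ())

edgeList-length : ∀ a r → length (edgeList (a ∷ r)) ≡ length r
edgeList-length a []      = refl
edgeList-length a (b ∷ r) = cong suc (edgeList-length b r)

_≈ᵉᵇ_ : Edge → Edge → Bool
e ≈ᵉᵇ e' = does (e ≈ᵉ? e')

≉ᵉᵇ-sound : ∀ e e' → T (not (e ≈ᵉᵇ e')) → ¬ e ≈ᵉ e'
≉ᵉᵇ-sound e e' holds e≈e' = subst (λ b → T (not b)) (dec-true (e ≈ᵉ? e') e≈e') holds

pairwiseDistinct : List Edge → Bool
pairwiseDistinct []       = true
pairwiseDistinct (e ∷ es) = all (λ e' → not (e ≈ᵉᵇ e')) es ∧ pairwiseDistinct es

pairwiseDistinct-sound : ∀ es {i j} → T (pairwiseDistinct es) → i < length es → j < length es →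
  nth (0 , 0) es i ≈ᵉ nth (0 , 0) es j → i ≡ j
pairwiseDistinct-sound (e ∷ es) {zero}  {zero}  _     _     _     _ = refl
pairwiseDistinct-sound (e ∷ es) {zero}  {suc j} holds _     j<len s =
  ⊥-elim (≉ᵉᵇ-sound e _ (all-nth _ (0 , 0) es (proj₁ (to T-∧ holds)) (s≤s⁻¹ j<len)) s)
pairwiseDistinct-sound (e ∷ es) {suc i} {zero}  holds i<len _     s =
  ⊥-elim (≉ᵉᵇ-sound e _ (all-nth _ (0 , 0) es (proj₁ (to T-∧ holds)) (s≤s⁻¹ i<len)) (≈ᵉ-sym s))
pairwiseDistinct-sound (e ∷ es) {suc i} {suc j} holds i<len j<len s =
  cong suc (pairwiseDistinct-sound es (proj₂ (to T-∧ holds)) (s≤s⁻¹ i<len) (s≤s⁻¹ j<len) s)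

closedWalk : List ℕ → List ℕ
closedWalk l = 0 ∷ l ++ [ 0 ]

loopFree : List Edge → Bool
loopFree = all (λ e → not ((0 , 0) ≈ᵉᵇ e))

validCycle : ℕ → List ℕ → Bool
validCycle k l =
  all (_<ᵇ k) (closedWalk l) ∧ pairwiseDistinct (edgeList (closedWalk l)) ∧ loopFree (edgeList (closedWalk l))

validPetal : ℕ → List ℕ → List ℕ → Bool
validPetal k l₂ l₃ = validCycle k l₂ ∧ validCycle k l₃
  ∧ all (λ e → all (λ e' → not (e ≈ᵉᵇ e')) (edgeList (closedWalk l₃))) (edgeList (closedWalk l₂))

module ListCycle (k : ℕ) (l : List ℕ) (valid : T (validCycle (suc k) l)) where

  w : List ℕ
  w = closedWalk l

  σ : ℕ → ℕ
  σ = nth 0 w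

  n : ℕ
  n = suc (length l)

  length-w : length w ≡ suc n
  length-w = cong suc (trans (length-++ l) (+-comm (length l) 1))

  length-edges : length (edgeList w) ≡ n
  length-edges = trans (edgeList-length 0 (l ++ [ 0 ])) (suc-injective length-w)

  edge≡ : ∀ {i} → i < n → nth (0 , 0) (edgeList w) i ≡ edge σ i
  edge≡ {i} i<n = edgeList-nth w (subst (suc i <_) (sym length-w) (s≤s i<n))

  end : σ n ≡ 0
  end = last l
    where
    last : ∀ l → nth 0 (l ++ [ 0 ]) (length l) ≡ 0
    last []      = refl
    last (_ ∷ l) = last l

  valid-below : T (all (_<ᵇ suc k) w)
  valid-below = proj₁ (to (T-∧ {all (_<ᵇ suc k) w}) valid)

  valid-rest : T (pairwiseDistinct (edgeList w)) × T (loopFree (edgeList w))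
  valid-rest = to (T-∧ {pairwiseDistinct (edgeList w)}) (proj₂ (to (T-∧ {all (_<ᵇ suc k) w}) valid))

  within : WalkIn (suc k) σ n
  within {i} _ with i <? length w
  ... | yes i<len = <ᵇ⇒< _ _ (all-nth (_<ᵇ suc k) 0 w valid-below i<len)
  ... | no  i≮len = subst (_< suc k) (sym (nth-beyond 0 w (≮⇒≥ i≮len))) z<s

  edge-index : ∀ {i} → i < n → i < length (edgeList w)
  edge-index = subst (_ <_) (sym length-edges)

  distinct : DistinctEdges σ n
  distinct i<n j<n s = pairwiseDistinct-sound (edgeList w) (proj₁ valid-rest) (edge-index i<n) (edge-index j<n)
                         (subst₂ _≈ᵉ_ (sym (edge≡ i<n)) (sym (edge≡ j<n)) s)

  noLoop : AvoidsLoop 0 σ n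
  noLoop i<n = subst (λ e → ¬ (0 , 0) ≈ᵉ e) (edge≡ i<n)
                 (≉ᵉᵇ-sound _ _ (all-nth _ (0 , 0) (edgeList w) (proj₂ valid-rest) (edge-index i<n)))

petal-from-lists : ∀ k l₂ l₃ → T (validPetal (suc k) l₂ l₃) → Drawing (suc k) 0 (suc (length l₂)) (suc (length l₃))
petal-from-lists k l₂ l₃ valid = record
  { σ₂ = C₂.σ ; σ₃ = C₃.σ
  ; hub<k = z<s ; within₂ = C₂.within ; within₃ = C₃.within
  ; start₂ = refl ; end₂ = C₂.end ; start₃ = refl ; end₃ = C₃.end
  ; distinct₂ = C₂.distinct ; distinct₃ = C₃.distinct
  ; disjoint = disjoint
  ; noLoop₂ = C₂.noLoop ; noLoop₃ = C₃.noLoop }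
  where
  es₂ es₃ : List Edge
  es₂ = edgeList (closedWalk l₂)
  es₃ = edgeList (closedWalk l₃)

  crossing : Bool
  crossing = all (λ e → all (λ e' → not (e ≈ᵉᵇ e')) es₃) es₂

  valid₂ : T (validCycle (suc k) l₂)
  valid₂ = proj₁ (to (T-∧ {validCycle (suc k) l₂}) valid)

  valid₃,crossing : T (validCycle (suc k) l₃) × T crossing
  valid₃,crossing = to (T-∧ {validCycle (suc k) l₃}) (proj₂ (to (T-∧ {validCycle (suc k) l₂}) valid))

  module C₂ = ListCycle k l₂ valid₂
  module C₃ = ListCycle k l₃ (proj₁ valid₃,crossing)

  disjoint : DisjointEdges C₂.σ C₂.n C₃.σ C₃.n
  disjoint i<n j<n s =
    ≉ᵉᵇ-sound _ _ (all-nth _ (0 , 0) es₃ (all-nth _ (0 , 0) es₂ (proj₂ valid₃,crossing) (C₂.edge-index i<n))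
                                      (C₃.edge-index j<n))
                  (subst₂ _≈ᵉ_ (sym (C₂.edge≡ i<n)) (sym (C₃.edge≡ j<n)) s)

Table : Set
Table = List (List (List ℕ × List ℕ))

∅ : List ℕ × List ℕ
∅ = [] , []

-- Entry (c₂, c₃) lists the inner vertices of the two cycles.
lookup : Table → ℕ → ℕ → List ℕ × List ℕ
lookup t c₂ c₃ = nth ∅ (nth [] t c₂) c₃

allBelow : ℕ → (ℕ → Bool) → Bool
allBelow zero    p = true
allBelow (suc n) p = allBelow n p ∧ p n

allBelow-sound : ∀ n p {m} → T (allBelow n p) → m < n → T (p m)
allBelow-sound (suc n) p {m} holds m<1+n with m≤n⇒m<n∨m≡n (s≤s⁻¹ m<1+n)
... | inj₁ m<n  = allBelow-sound n p (proj₁ (to (T-∧ {allBelow n p}) holds)) m<n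
... | inj₂ refl = proj₂ (to (T-∧ {allBelow n p}) holds)

admissible : ℕ → ℕ → ℕ → Bool
admissible B c₂ c₃ = (3 ≤ᵇ c₂) ∧ (c₂ ≤ᵇ c₃) ∧ (1 + c₂ + c₃ ≤ᵇ B)

entryValid : ℕ → Table → ℕ → ℕ → Bool
entryValid k t c₂ c₃ = validPetal k l₂ l₃ ∧ (suc (length l₂) ≡ᵇ c₂) ∧ (suc (length l₃) ≡ᵇ c₃)
  where
  l₂ l₃ : List ℕ
  l₂ = proj₁ (lookup t c₂ c₃)
  l₃ = proj₂ (lookup t c₂ c₃)

covers : ℕ → ℕ → Table → Bool
covers k B t = allBelow B (λ c₂ → allBelow B (λ c₃ → not (admissible B c₂ c₃) ∨ entryValid k t c₂ c₃))

covers-sound : ∀ k B t → T (covers (suc k) B t) → OrderedConstructible (suc k) B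
covers-sound k B t holds c₂ c₃ 3≤c₂ c₂≤c₃ bound =
  subst₂ (Drawing (suc k) 0) (≡ᵇ⇒≡ _ _ (proj₁ lengths)) (≡ᵇ⇒≡ _ _ (proj₂ lengths)) (petal-from-lists k l₂ l₃ valid)
  where
  l₂ l₃ : List ℕ
  l₂ = proj₁ (lookup t c₂ c₃)
  l₃ = proj₂ (lookup t c₂ c₃)

  c₂<B : c₂ < B
  c₂<B = <-≤-trans (s≤s (m≤m+n c₂ c₃)) bound

  c₃<B : c₃ < B
  c₃<B = <-≤-trans (s≤s (m≤n+m c₃ c₂)) bound

  entry : T (not (admissible B c₂ c₃) ∨ entryValid (suc k) t c₂ c₃)
  entry = allBelow-sound B _ (allBelow-sound B _ holds c₂<B) c₃<B

  admitted : T (admissible B c₂ c₃)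
  admitted = from T-∧ (≤⇒≤ᵇ 3≤c₂ , from T-∧ (≤⇒≤ᵇ c₂≤c₃ , ≤⇒≤ᵇ bound))

  entry-valid : T (entryValid (suc k) t c₂ c₃)
  entry-valid with to (T-∨ {not (admissible B c₂ c₃)}) entry
  ... | inj₂ ok = ok
  ... | inj₁ not-admitted = contradiction admitted (T-not not-admitted)
    where
    T-not : ∀ {b} → T (not b) → ¬ T b
    T-not {false} _ ()

  valid : T (validPetal (suc k) l₂ l₃)
  valid = proj₁ (to (T-∧ {validPetal (suc k) l₂ l₃}) entry-valid)

  lengths : T (suc (length l₂) ≡ᵇ c₂) × T (suc (length l₃) ≡ᵇ c₃)
  lengths = to (T-∧ {suc (length l₂) ≡ᵇ c₂}) (proj₂ (to (T-∧ {validPetal (suc k) l₂ l₃}) entry-valid))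

table₆ : Table
table₆ = []
  ∷ []
  ∷ []
  ∷ (∅ ∷ ∅ ∷ ∅ ∷ ((4 ∷ 1 ∷ []) , (3 ∷ 5 ∷ [])) ∷ ((4 ∷ 1 ∷ []) , (3 ∷ 1 ∷ 2 ∷ [])) ∷ ((4 ∷ 1 ∷ []) , (3 ∷ 1 ∷ 1 ∷ 2 ∷ [])) ∷ ((4 ∷ 1 ∷ []) , (3 ∷ 1 ∷ 1 ∷ 2 ∷ 2 ∷ [])) ∷ ((4 ∷ 1 ∷ []) , (3 ∷ 1 ∷ 1 ∷ 2 ∷ 2 ∷ 5 ∷ [])) ∷ ((4 ∷ 1 ∷ []) , (3 ∷ 1 ∷ 1 ∷ 2 ∷ 2 ∷ 4 ∷ 5 ∷ [])) ∷ ((4 ∷ 1 ∷ []) , (3 ∷ 1 ∷ 1 ∷ 2 ∷ 2 ∷ 4 ∷ 4 ∷ 5 ∷ [])) ∷ ((4 ∷ 1 ∷ []) , (3 ∷ 1 ∷ 1 ∷ 2 ∷ 2 ∷ 4 ∷ 4 ∷ 5 ∷ 5 ∷ [])) ∷ ((4 ∷ 1 ∷ []) , (3 ∷ 1 ∷ 1 ∷ 2 ∷ 2 ∷ 4 ∷ 4 ∷ 5 ∷ 3 ∷ 2 ∷ [])) ∷ ((4 ∷ 1 ∷ []) , (3 ∷ 1 ∷ 1 ∷ 2 ∷ 2 ∷ 4 ∷ 4 ∷ 5 ∷ 3 ∷ 3 ∷ 2 ∷ [])) ∷ ((4 ∷ 1 ∷ []) , (3 ∷ 1 ∷ 1 ∷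 2 ∷ 2 ∷ 4 ∷ 4 ∷ 5 ∷ 3 ∷ 3 ∷ 2 ∷ 5 ∷ [])) ∷ ((4 ∷ 1 ∷ []) , (3 ∷ 1 ∷ 1 ∷ 2 ∷ 2 ∷ 4 ∷ 4 ∷ 5 ∷ 3 ∷ 3 ∷ 2 ∷ 5 ∷ 5 ∷ [])) ∷ [])
  ∷ (∅ ∷ ∅ ∷ ∅ ∷ ∅ ∷ ((4 ∷ 4 ∷ 5 ∷ []) , (3 ∷ 1 ∷ 1 ∷ [])) ∷ ((4 ∷ 4 ∷ 5 ∷ []) , (3 ∷ 1 ∷ 1 ∷ 2 ∷ [])) ∷ ((4 ∷ 4 ∷ 5 ∷ []) , (3 ∷ 1 ∷ 1 ∷ 5 ∷ 2 ∷ [])) ∷ ((4 ∷ 4 ∷ 5 ∷ []) , (3 ∷ 1 ∷ 1 ∷ 2 ∷ 5 ∷ 1 ∷ [])) ∷ ((4 ∷ 4 ∷ 5 ∷ []) , (3 ∷ 1 ∷ 1 ∷ 5 ∷ 5 ∷ 2 ∷ 2 ∷ [])) ∷ ((4 ∷ 4 ∷ 5 ∷ []) , (3 ∷ 1 ∷ 1 ∷ 4 ∷ 2 ∷ 5 ∷ 5 ∷ 1 ∷ [])) ∷ ((4 ∷ 4 ∷ 5 ∷ []) , (3 ∷ 1 ∷ 1 ∷ 5 ∷ 3 ∷ 2 ∷ 4 ∷ 1 ∷ 2 ∷ [])) ∷ ((4 ∷ 4 ∷ 5 ∷ []) , (3 ∷ 1 ∷ 1 ∷ 5 ∷ 5 ∷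 2 ∷ 2 ∷ 1 ∷ 4 ∷ 2 ∷ [])) ∷ ((4 ∷ 4 ∷ 5 ∷ []) , (3 ∷ 1 ∷ 1 ∷ 5 ∷ 2 ∷ 1 ∷ 4 ∷ 3 ∷ 3 ∷ 2 ∷ 2 ∷ [])) ∷ ((4 ∷ 4 ∷ 5 ∷ []) , (3 ∷ 1 ∷ 1 ∷ 5 ∷ 5 ∷ 3 ∷ 3 ∷ 2 ∷ 2 ∷ 4 ∷ 1 ∷ 2 ∷ [])) ∷ [])
  ∷ (∅ ∷ ∅ ∷ ∅ ∷ ∅ ∷ ∅ ∷ ((4 ∷ 4 ∷ 5 ∷ 5 ∷ []) , (1 ∷ 1 ∷ 2 ∷ 2 ∷ [])) ∷ ((4 ∷ 4 ∷ 5 ∷ 5 ∷ []) , (1 ∷ 1 ∷ 2 ∷ 2 ∷ 3 ∷ [])) ∷ ((4 ∷ 4 ∷ 5 ∷ 5 ∷ []) , (1 ∷ 1 ∷ 2 ∷ 2 ∷ 4 ∷ 3 ∷ [])) ∷ ((4 ∷ 4 ∷ 5 ∷ 5 ∷ []) , (1 ∷ 1 ∷ 2 ∷ 2 ∷ 4 ∷ 3 ∷ 3 ∷ [])) ∷ ((4 ∷ 4 ∷ 5 ∷ 5 ∷ []) , (1 ∷ 1 ∷ 2 ∷ 2 ∷ 4 ∷ 3 ∷ 5 ∷ 2 ∷ [])) ∷ ((4 ∷ 4 ∷ 5 ∷ 5 ∷ []) , (1 ∷ 1 ∷ 2 ∷ 2 ∷ 4 ∷ 3 ∷ 5 ∷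 1 ∷ 3 ∷ [])) ∷ ((4 ∷ 4 ∷ 5 ∷ 5 ∷ []) , (1 ∷ 1 ∷ 2 ∷ 2 ∷ 4 ∷ 3 ∷ 5 ∷ 1 ∷ 3 ∷ 2 ∷ [])) ∷ ((4 ∷ 4 ∷ 5 ∷ 5 ∷ []) , (1 ∷ 1 ∷ 2 ∷ 2 ∷ 4 ∷ 3 ∷ 5 ∷ 1 ∷ 3 ∷ 3 ∷ 2 ∷ [])) ∷ [])
  ∷ (∅ ∷ ∅ ∷ ∅ ∷ ∅ ∷ ∅ ∷ ∅ ∷ ((4 ∷ 4 ∷ 5 ∷ 5 ∷ 3 ∷ []) , (1 ∷ 2 ∷ 4 ∷ 3 ∷ 2 ∷ [])) ∷ ((4 ∷ 4 ∷ 5 ∷ 5 ∷ 3 ∷ []) , (1 ∷ 2 ∷ 2 ∷ 4 ∷ 3 ∷ 2 ∷ [])) ∷ ((4 ∷ 4 ∷ 5 ∷ 5 ∷ 3 ∷ []) , (1 ∷ 2 ∷ 2 ∷ 4 ∷ 3 ∷ 1 ∷ 5 ∷ [])) ∷ ((4 ∷ 4 ∷ 5 ∷ 5 ∷ 3 ∷ []) , (1 ∷ 2 ∷ 2 ∷ 4 ∷ 3 ∷ 1 ∷ 1 ∷ 5 ∷ [])) ∷ ((4 ∷ 4 ∷ 5 ∷ 5 ∷ 3 ∷ []) , (1 ∷ 2 ∷ 2 ∷ 4 ∷ 3 ∷ 1 ∷ 1 ∷ 5 ∷ 2 ∷ [])) ∷ ((4 ∷ 4 ∷ 5 ∷ 5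 ∷ 3 ∷ []) , (1 ∷ 2 ∷ 2 ∷ 4 ∷ 3 ∷ 3 ∷ 1 ∷ 1 ∷ 5 ∷ 2 ∷ [])) ∷ [])
  ∷ (∅ ∷ ∅ ∷ ∅ ∷ ∅ ∷ ∅ ∷ ∅ ∷ ∅ ∷ ((4 ∷ 4 ∷ 5 ∷ 5 ∷ 3 ∷ 1 ∷ []) , (2 ∷ 2 ∷ 1 ∷ 4 ∷ 3 ∷ 3 ∷ [])) ∷ ((4 ∷ 4 ∷ 5 ∷ 5 ∷ 3 ∷ 1 ∷ []) , (2 ∷ 2 ∷ 1 ∷ 4 ∷ 3 ∷ 2 ∷ 5 ∷ [])) ∷ ((4 ∷ 4 ∷ 5 ∷ 5 ∷ 3 ∷ 1 ∷ []) , (2 ∷ 2 ∷ 1 ∷ 4 ∷ 3 ∷ 3 ∷ 2 ∷ 5 ∷ [])) ∷ ((4 ∷ 4 ∷ 5 ∷ 5 ∷ 3 ∷ 1 ∷ []) , (2 ∷ 2 ∷ 1 ∷ 1 ∷ 5 ∷ 2 ∷ 4 ∷ 3 ∷ 3 ∷ [])) ∷ [])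
  ∷ (∅ ∷ ∅ ∷ ∅ ∷ ∅ ∷ ∅ ∷ ∅ ∷ ∅ ∷ ∅ ∷ ((4 ∷ 4 ∷ 5 ∷ 5 ∷ 3 ∷ 1 ∷ 1 ∷ []) , (3 ∷ 4 ∷ 2 ∷ 5 ∷ 1 ∷ 2 ∷ 2 ∷ [])) ∷ ((4 ∷ 4 ∷ 5 ∷ 5 ∷ 3 ∷ 1 ∷ 1 ∷ []) , (3 ∷ 3 ∷ 2 ∷ 4 ∷ 1 ∷ 5 ∷ 2 ∷ 2 ∷ [])) ∷ [])
  ∷ []

table₈ : Table
table₈ = []
  ∷ []
  ∷ []
  ∷ (∅ ∷ ∅ ∷ ∅ ∷ ((4 ∷ 1 ∷ []) , (3 ∷ 6 ∷ [])) ∷ ((4 ∷ 1 ∷ []) , (3 ∷ 6 ∷ 5 ∷ [])) ∷ ((4 ∷ 1 ∷ []) , (3 ∷ 6 ∷ 1 ∷ 2 ∷ [])) ∷ ((4 ∷ 1 ∷ []) , (3 ∷ 6 ∷ 1 ∷ 2 ∷ 2 ∷ [])) ∷ ((4 ∷ 1 ∷ []) , (3 ∷ 6 ∷ 1 ∷ 2 ∷ 3 ∷ 5 ∷ [])) ∷ ((4 ∷ 1 ∷ []) , (3 ∷ 6 ∷ 1 ∷ 2 ∷ 3 ∷ 4 ∷ 6 ∷ [])) ∷ ((4 ∷ 1 ∷ []) , (3 ∷ 6 ∷ 1 ∷ 2 ∷ 3 ∷ 4 ∷ 6 ∷ 2 ∷ [])) ∷ ((4 ∷ 1 ∷ [])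 , (3 ∷ 6 ∷ 1 ∷ 2 ∷ 3 ∷ 4 ∷ 6 ∷ 2 ∷ 7 ∷ [])) ∷ ((4 ∷ 1 ∷ []) , (3 ∷ 6 ∷ 1 ∷ 2 ∷ 3 ∷ 4 ∷ 6 ∷ 2 ∷ 7 ∷ 5 ∷ [])) ∷ ((4 ∷ 1 ∷ []) , (3 ∷ 6 ∷ 1 ∷ 2 ∷ 3 ∷ 4 ∷ 6 ∷ 2 ∷ 7 ∷ 3 ∷ 5 ∷ [])) ∷ ((4 ∷ 1 ∷ []) , (3 ∷ 6 ∷ 1 ∷ 2 ∷ 3 ∷ 4 ∷ 6 ∷ 2 ∷ 7 ∷ 3 ∷ 1 ∷ 7 ∷ [])) ∷ ((4 ∷ 1 ∷ []) , (3 ∷ 6 ∷ 1 ∷ 2 ∷ 3 ∷ 4 ∷ 6 ∷ 2 ∷ 7 ∷ 3 ∷ 1 ∷ 1 ∷ 7 ∷ [])) ∷ ((4 ∷ 1 ∷ []) , (3 ∷ 6 ∷ 1 ∷ 2 ∷ 3 ∷ 4 ∷ 6 ∷ 2 ∷ 7 ∷ 3 ∷ 1 ∷ 1 ∷ 7 ∷ 6 ∷ [])) ∷ ((4 ∷ 1 ∷ []) , (3 ∷ 6 ∷ 1 ∷ 2 ∷ 3 ∷ 4 ∷ 6 ∷ 2 ∷ 7 ∷ 3 ∷ 1 ∷ 1 ∷ 7 ∷ 6 ∷ 6 ∷ [])) ∷ ((4 ∷ 1 ∷ []) , (3 ∷ 6 ∷ 1 ∷ 2 ∷ 3 ∷ 4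 ∷ 6 ∷ 2 ∷ 7 ∷ 3 ∷ 1 ∷ 1 ∷ 7 ∷ 6 ∷ 6 ∷ 5 ∷ [])) ∷ ((4 ∷ 1 ∷ []) , (3 ∷ 6 ∷ 1 ∷ 2 ∷ 3 ∷ 4 ∷ 6 ∷ 2 ∷ 7 ∷ 3 ∷ 1 ∷ 1 ∷ 7 ∷ 6 ∷ 0 ∷ 7 ∷ 5 ∷ [])) ∷ ((4 ∷ 1 ∷ []) , (3 ∷ 6 ∷ 1 ∷ 2 ∷ 3 ∷ 4 ∷ 6 ∷ 2 ∷ 7 ∷ 3 ∷ 1 ∷ 1 ∷ 7 ∷ 6 ∷ 0 ∷ 7 ∷ 4 ∷ 2 ∷ [])) ∷ ((4 ∷ 1 ∷ []) , (3 ∷ 6 ∷ 1 ∷ 2 ∷ 3 ∷ 4 ∷ 6 ∷ 2 ∷ 7 ∷ 3 ∷ 1 ∷ 1 ∷ 7 ∷ 6 ∷ 0 ∷ 7 ∷ 4 ∷ 2 ∷ 5 ∷ [])) ∷ ((4 ∷ 1 ∷ []) , (3 ∷ 6 ∷ 1 ∷ 2 ∷ 3 ∷ 4 ∷ 6 ∷ 2 ∷ 7 ∷ 3 ∷ 1 ∷ 1 ∷ 7 ∷ 6 ∷ 0 ∷ 7 ∷ 4 ∷ 2 ∷ 5 ∷ 5 ∷ [])) ∷ ((4 ∷ 1 ∷ []) , (3 ∷ 6 ∷ 1 ∷ 2 ∷ 3 ∷ 4 ∷ 6 ∷ 2 ∷ 7 ∷ 3 ∷ 1 ∷ 1 ∷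 7 ∷ 6 ∷ 0 ∷ 7 ∷ 4 ∷ 2 ∷ 2 ∷ 5 ∷ 5 ∷ [])) ∷ ((4 ∷ 1 ∷ []) , (3 ∷ 6 ∷ 1 ∷ 2 ∷ 3 ∷ 4 ∷ 6 ∷ 2 ∷ 7 ∷ 3 ∷ 1 ∷ 1 ∷ 7 ∷ 6 ∷ 0 ∷ 7 ∷ 4 ∷ 4 ∷ 2 ∷ 2 ∷ 5 ∷ 5 ∷ [])) ∷ ((4 ∷ 1 ∷ []) , (3 ∷ 6 ∷ 1 ∷ 2 ∷ 3 ∷ 4 ∷ 6 ∷ 2 ∷ 7 ∷ 3 ∷ 1 ∷ 1 ∷ 7 ∷ 6 ∷ 0 ∷ 7 ∷ 5 ∷ 4 ∷ 4 ∷ 2 ∷ 2 ∷ 5 ∷ 5 ∷ [])) ∷ ((4 ∷ 1 ∷ []) , (3 ∷ 6 ∷ 1 ∷ 2 ∷ 3 ∷ 4 ∷ 6 ∷ 2 ∷ 7 ∷ 3 ∷ 1 ∷ 1 ∷ 7 ∷ 6 ∷ 0 ∷ 7 ∷ 7 ∷ 5 ∷ 2 ∷ 2 ∷ 4 ∷ 4 ∷ 5 ∷ 5 ∷ [])) ∷ ((4 ∷ 1 ∷ []) , (3 ∷ 6 ∷ 1 ∷ 2 ∷ 3 ∷ 4 ∷ 6 ∷ 2 ∷ 7 ∷ 3 ∷ 1 ∷ 1 ∷ 7 ∷ 6 ∷ 6 ∷ 5 ∷ 2 ∷ 2 ∷ 0 ∷ 5 ∷ 5 ∷ 4 ∷ 4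 ∷ 7 ∷ 7 ∷ [])) ∷ ((4 ∷ 1 ∷ []) , (3 ∷ 6 ∷ 1 ∷ 2 ∷ 3 ∷ 4 ∷ 6 ∷ 2 ∷ 7 ∷ 3 ∷ 1 ∷ 1 ∷ 5 ∷ 5 ∷ 0 ∷ 7 ∷ 4 ∷ 4 ∷ 5 ∷ 7 ∷ 7 ∷ 6 ∷ 6 ∷ 5 ∷ 2 ∷ 2 ∷ [])) ∷ ((1 ∷ 4 ∷ []) , (2 ∷ 1 ∷ 1 ∷ 5 ∷ 4 ∷ 7 ∷ 0 ∷ 6 ∷ 1 ∷ 3 ∷ 6 ∷ 5 ∷ 5 ∷ 2 ∷ 4 ∷ 4 ∷ 3 ∷ 7 ∷ 6 ∷ 6 ∷ 2 ∷ 2 ∷ 7 ∷ 7 ∷ 5 ∷ 3 ∷ 3 ∷ [])) ∷ [])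
  ∷ (∅ ∷ ∅ ∷ ∅ ∷ ∅ ∷ ((4 ∷ 1 ∷ 5 ∷ []) , (6 ∷ 1 ∷ 2 ∷ [])) ∷ ((4 ∷ 1 ∷ 5 ∷ []) , (6 ∷ 1 ∷ 2 ∷ 3 ∷ [])) ∷ ((4 ∷ 1 ∷ 5 ∷ []) , (6 ∷ 1 ∷ 2 ∷ 3 ∷ 1 ∷ [])) ∷ ((4 ∷ 1 ∷ 5 ∷ []) , (6 ∷ 1 ∷ 2 ∷ 3 ∷ 4 ∷ 2 ∷ [])) ∷ ((4 ∷ 1 ∷ 5 ∷ []) , (6 ∷ 1 ∷ 2 ∷ 3 ∷ 4 ∷ 6 ∷ 2 ∷ [])) ∷ ((4 ∷ 1 ∷ 5 ∷ []) , (6 ∷ 1 ∷ 2 ∷ 3 ∷ 4 ∷ 6 ∷ 2 ∷ 7 ∷ [])) ∷ ((4 ∷ 1 ∷ 5 ∷ []) , (6 ∷ 1 ∷ 2 ∷ 3 ∷ 4 ∷ 6 ∷ 2 ∷ 7 ∷ 3 ∷ [])) ∷ ((4 ∷ 1 ∷ 5 ∷ []) , (6 ∷ 1 ∷ 2 ∷ 3 ∷ 4 ∷ 6 ∷ 2 ∷ 7 ∷ 3 ∷ 1 ∷ [])) ∷ ((4 ∷ 1 ∷ 5 ∷ []) , (6 ∷ 1 ∷ 2 ∷ 3 ∷ 4 ∷ 6 ∷ 2 ∷ 7 ∷ 3 ∷ 1 ∷ 1 ∷ [])) ∷ ((4 ∷ 1 ∷ 5 ∷ []) , (6 ∷ 1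 ∷ 2 ∷ 3 ∷ 4 ∷ 6 ∷ 2 ∷ 7 ∷ 3 ∷ 1 ∷ 1 ∷ 7 ∷ [])) ∷ ((4 ∷ 1 ∷ 5 ∷ []) , (6 ∷ 1 ∷ 2 ∷ 3 ∷ 4 ∷ 6 ∷ 2 ∷ 7 ∷ 3 ∷ 1 ∷ 1 ∷ 7 ∷ 7 ∷ [])) ∷ ((4 ∷ 1 ∷ 5 ∷ []) , (6 ∷ 1 ∷ 2 ∷ 3 ∷ 4 ∷ 6 ∷ 2 ∷ 7 ∷ 3 ∷ 1 ∷ 0 ∷ 3 ∷ 6 ∷ 7 ∷ [])) ∷ ((4 ∷ 1 ∷ 5 ∷ []) , (6 ∷ 1 ∷ 2 ∷ 3 ∷ 4 ∷ 6 ∷ 2 ∷ 7 ∷ 3 ∷ 1 ∷ 0 ∷ 3 ∷ 6 ∷ 7 ∷ 7 ∷ [])) ∷ ((4 ∷ 1 ∷ 5 ∷ []) , (6 ∷ 1 ∷ 2 ∷ 3 ∷ 4 ∷ 6 ∷ 2 ∷ 7 ∷ 3 ∷ 1 ∷ 0 ∷ 3 ∷ 6 ∷ 7 ∷ 4 ∷ 2 ∷ [])) ∷ ((4 ∷ 1 ∷ 5 ∷ []) , (6 ∷ 1 ∷ 2 ∷ 3 ∷ 4 ∷ 6 ∷ 2 ∷ 7 ∷ 3 ∷ 1 ∷ 0 ∷ 3 ∷ 6 ∷ 7 ∷ 4 ∷ 2 ∷ 2 ∷ [])) ∷ ((4 ∷ 1 ∷ 5 ∷ []) , (6 ∷ 1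 ∷ 2 ∷ 3 ∷ 4 ∷ 6 ∷ 2 ∷ 7 ∷ 3 ∷ 1 ∷ 0 ∷ 3 ∷ 6 ∷ 7 ∷ 4 ∷ 2 ∷ 5 ∷ 7 ∷ [])) ∷ ((4 ∷ 1 ∷ 5 ∷ []) , (6 ∷ 1 ∷ 2 ∷ 3 ∷ 4 ∷ 6 ∷ 2 ∷ 7 ∷ 3 ∷ 1 ∷ 0 ∷ 3 ∷ 6 ∷ 7 ∷ 4 ∷ 2 ∷ 2 ∷ 5 ∷ 7 ∷ [])) ∷ ((4 ∷ 1 ∷ 5 ∷ []) , (6 ∷ 1 ∷ 2 ∷ 3 ∷ 4 ∷ 6 ∷ 2 ∷ 7 ∷ 3 ∷ 1 ∷ 0 ∷ 3 ∷ 6 ∷ 7 ∷ 4 ∷ 2 ∷ 2 ∷ 5 ∷ 5 ∷ 7 ∷ [])) ∷ ((4 ∷ 1 ∷ 5 ∷ []) , (6 ∷ 1 ∷ 2 ∷ 3 ∷ 4 ∷ 6 ∷ 2 ∷ 7 ∷ 3 ∷ 1 ∷ 0 ∷ 3 ∷ 6 ∷ 7 ∷ 4 ∷ 2 ∷ 2 ∷ 5 ∷ 5 ∷ 7 ∷ 7 ∷ [])) ∷ ((4 ∷ 1 ∷ 5 ∷ []) , (6 ∷ 1 ∷ 2 ∷ 3 ∷ 4 ∷ 6 ∷ 2 ∷ 7 ∷ 3 ∷ 1 ∷ 0 ∷ 3 ∷ 6 ∷ 7 ∷ 4 ∷ 4 ∷ 2 ∷ 2 ∷ 5 ∷ 5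 ∷ 7 ∷ 7 ∷ [])) ∷ ((4 ∷ 1 ∷ 5 ∷ []) , (6 ∷ 1 ∷ 2 ∷ 3 ∷ 4 ∷ 6 ∷ 2 ∷ 7 ∷ 3 ∷ 1 ∷ 0 ∷ 3 ∷ 6 ∷ 6 ∷ 7 ∷ 4 ∷ 4 ∷ 2 ∷ 2 ∷ 5 ∷ 5 ∷ 7 ∷ 7 ∷ [])) ∷ ((4 ∷ 1 ∷ 5 ∷ []) , (6 ∷ 1 ∷ 2 ∷ 3 ∷ 4 ∷ 6 ∷ 2 ∷ 7 ∷ 3 ∷ 1 ∷ 0 ∷ 3 ∷ 5 ∷ 6 ∷ 6 ∷ 7 ∷ 7 ∷ 4 ∷ 4 ∷ 2 ∷ 2 ∷ 5 ∷ 5 ∷ 7 ∷ [])) ∷ ((4 ∷ 1 ∷ 5 ∷ []) , (6 ∷ 1 ∷ 2 ∷ 3 ∷ 4 ∷ 6 ∷ 2 ∷ 7 ∷ 3 ∷ 1 ∷ 0 ∷ 3 ∷ 3 ∷ 5 ∷ 6 ∷ 6 ∷ 7 ∷ 7 ∷ 5 ∷ 5 ∷ 2 ∷ 2 ∷ 4 ∷ 4 ∷ 7 ∷ [])) ∷ ((4 ∷ 4 ∷ 2 ∷ []) , (1 ∷ 5 ∷ 4 ∷ 7 ∷ 0 ∷ 6 ∷ 1 ∷ 1 ∷ 3 ∷ 5 ∷ 5 ∷ 2 ∷ 1 ∷ 4 ∷ 3 ∷ 6 ∷ 6 ∷ 7 ∷ 2 ∷ 2 ∷ 6 ∷ 5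 ∷ 7 ∷ 7 ∷ 3 ∷ 3 ∷ [])) ∷ [])
  ∷ (∅ ∷ ∅ ∷ ∅ ∷ ∅ ∷ ∅ ∷ ((4 ∷ 1 ∷ 5 ∷ 3 ∷ []) , (1 ∷ 2 ∷ 3 ∷ 6 ∷ [])) ∷ ((4 ∷ 1 ∷ 5 ∷ 3 ∷ []) , (1 ∷ 2 ∷ 3 ∷ 4 ∷ 6 ∷ [])) ∷ ((4 ∷ 1 ∷ 5 ∷ 3 ∷ []) , (1 ∷ 2 ∷ 3 ∷ 4 ∷ 6 ∷ 2 ∷ [])) ∷ ((4 ∷ 1 ∷ 5 ∷ 3 ∷ []) , (1 ∷ 2 ∷ 3 ∷ 4 ∷ 6 ∷ 2 ∷ 7 ∷ [])) ∷ ((4 ∷ 1 ∷ 5 ∷ 3 ∷ []) , (1 ∷ 2 ∷ 3 ∷ 4 ∷ 6 ∷ 2 ∷ 7 ∷ 5 ∷ [])) ∷ ((4 ∷ 1 ∷ 5 ∷ 3 ∷ []) , (1 ∷ 2 ∷ 3 ∷ 4 ∷ 6 ∷ 2 ∷ 7 ∷ 3 ∷ 6 ∷ [])) ∷ ((4 ∷ 1 ∷ 5 ∷ 3 ∷ []) , (1 ∷ 2 ∷ 3 ∷ 4 ∷ 6 ∷ 2 ∷ 7 ∷ 3 ∷ 1 ∷ 6 ∷ [])) ∷ ((4 ∷ 1 ∷ 5 ∷ 3 ∷ []) , (1 ∷ 2 ∷ 3 ∷ 4 ∷ 6 ∷ 2 ∷ 7 ∷ 3 ∷ 1 ∷ 6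 ∷ 7 ∷ [])) ∷ ((4 ∷ 1 ∷ 5 ∷ 3 ∷ []) , (1 ∷ 2 ∷ 3 ∷ 4 ∷ 6 ∷ 2 ∷ 7 ∷ 3 ∷ 1 ∷ 6 ∷ 7 ∷ 7 ∷ [])) ∷ ((4 ∷ 1 ∷ 5 ∷ 3 ∷ []) , (1 ∷ 2 ∷ 3 ∷ 4 ∷ 6 ∷ 2 ∷ 7 ∷ 3 ∷ 1 ∷ 6 ∷ 7 ∷ 4 ∷ 2 ∷ [])) ∷ ((4 ∷ 1 ∷ 5 ∷ 3 ∷ []) , (1 ∷ 2 ∷ 3 ∷ 4 ∷ 6 ∷ 2 ∷ 7 ∷ 3 ∷ 1 ∷ 6 ∷ 7 ∷ 4 ∷ 2 ∷ 2 ∷ [])) ∷ ((4 ∷ 1 ∷ 5 ∷ 3 ∷ []) , (1 ∷ 2 ∷ 3 ∷ 4 ∷ 6 ∷ 2 ∷ 7 ∷ 3 ∷ 1 ∷ 6 ∷ 7 ∷ 4 ∷ 2 ∷ 2 ∷ 5 ∷ [])) ∷ ((4 ∷ 1 ∷ 5 ∷ 3 ∷ []) , (1 ∷ 2 ∷ 3 ∷ 4 ∷ 6 ∷ 2 ∷ 7 ∷ 3 ∷ 1 ∷ 6 ∷ 7 ∷ 4 ∷ 2 ∷ 2 ∷ 5 ∷ 5 ∷ [])) ∷ ((4 ∷ 1 ∷ 5 ∷ 3 ∷ []) , (1 ∷ 2 ∷ 3 ∷ 4 ∷ 6 ∷ 2 ∷ 7 ∷ 3 ∷ 1 ∷ 6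 ∷ 7 ∷ 4 ∷ 2 ∷ 2 ∷ 5 ∷ 5 ∷ 7 ∷ [])) ∷ ((4 ∷ 1 ∷ 5 ∷ 3 ∷ []) , (1 ∷ 2 ∷ 3 ∷ 4 ∷ 6 ∷ 2 ∷ 7 ∷ 3 ∷ 1 ∷ 6 ∷ 7 ∷ 4 ∷ 2 ∷ 2 ∷ 5 ∷ 5 ∷ 7 ∷ 7 ∷ [])) ∷ ((4 ∷ 1 ∷ 5 ∷ 3 ∷ []) , (1 ∷ 2 ∷ 3 ∷ 4 ∷ 6 ∷ 2 ∷ 7 ∷ 3 ∷ 1 ∷ 6 ∷ 7 ∷ 4 ∷ 2 ∷ 2 ∷ 5 ∷ 7 ∷ 0 ∷ 6 ∷ 5 ∷ [])) ∷ ((4 ∷ 1 ∷ 5 ∷ 3 ∷ []) , (1 ∷ 2 ∷ 3 ∷ 4 ∷ 6 ∷ 2 ∷ 7 ∷ 3 ∷ 1 ∷ 6 ∷ 7 ∷ 4 ∷ 2 ∷ 2 ∷ 5 ∷ 5 ∷ 7 ∷ 0 ∷ 6 ∷ 5 ∷ [])) ∷ ((4 ∷ 1 ∷ 5 ∷ 3 ∷ []) , (1 ∷ 2 ∷ 3 ∷ 4 ∷ 6 ∷ 2 ∷ 7 ∷ 3 ∷ 1 ∷ 6 ∷ 7 ∷ 4 ∷ 2 ∷ 2 ∷ 5 ∷ 5 ∷ 7 ∷ 7 ∷ 0 ∷ 6 ∷ 5 ∷ [])) ∷ ((4 ∷ 1 ∷ 5 ∷ 3 ∷ []) , (1 ∷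 2 ∷ 3 ∷ 4 ∷ 6 ∷ 2 ∷ 7 ∷ 3 ∷ 1 ∷ 6 ∷ 7 ∷ 4 ∷ 2 ∷ 2 ∷ 5 ∷ 5 ∷ 7 ∷ 7 ∷ 0 ∷ 6 ∷ 6 ∷ 5 ∷ [])) ∷ ((4 ∷ 1 ∷ 5 ∷ 3 ∷ []) , (1 ∷ 2 ∷ 3 ∷ 4 ∷ 6 ∷ 2 ∷ 7 ∷ 3 ∷ 1 ∷ 6 ∷ 7 ∷ 4 ∷ 4 ∷ 2 ∷ 2 ∷ 5 ∷ 6 ∷ 6 ∷ 0 ∷ 7 ∷ 7 ∷ 5 ∷ 5 ∷ [])) ∷ ((4 ∷ 4 ∷ 1 ∷ 1 ∷ []) , (2 ∷ 7 ∷ 0 ∷ 6 ∷ 1 ∷ 3 ∷ 6 ∷ 5 ∷ 5 ∷ 2 ∷ 4 ∷ 6 ∷ 6 ∷ 7 ∷ 1 ∷ 2 ∷ 2 ∷ 3 ∷ 4 ∷ 7 ∷ 7 ∷ 5 ∷ 3 ∷ 3 ∷ [])) ∷ ((4 ∷ 4 ∷ 1 ∷ 1 ∷ []) , (2 ∷ 7 ∷ 0 ∷ 6 ∷ 1 ∷ 3 ∷ 6 ∷ 5 ∷ 5 ∷ 2 ∷ 4 ∷ 6 ∷ 6 ∷ 7 ∷ 1 ∷ 2 ∷ 2 ∷ 3 ∷ 4 ∷ 5 ∷ 7 ∷ 7 ∷ 3 ∷ 3 ∷ 5 ∷ [])) ∷ [])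
  ∷ (∅ ∷ ∅ ∷ ∅ ∷ ∅ ∷ ∅ ∷ ∅ ∷ ((4 ∷ 1 ∷ 5 ∷ 3 ∷ 6 ∷ []) , (3 ∷ 4 ∷ 6 ∷ 2 ∷ 7 ∷ [])) ∷ ((4 ∷ 1 ∷ 5 ∷ 3 ∷ 6 ∷ []) , (3 ∷ 4 ∷ 6 ∷ 2 ∷ 3 ∷ 1 ∷ [])) ∷ ((4 ∷ 1 ∷ 5 ∷ 3 ∷ 6 ∷ []) , (3 ∷ 4 ∷ 6 ∷ 2 ∷ 3 ∷ 3 ∷ 1 ∷ [])) ∷ ((4 ∷ 1 ∷ 5 ∷ 3 ∷ 6 ∷ []) , (3 ∷ 4 ∷ 6 ∷ 2 ∷ 3 ∷ 3 ∷ 1 ∷ 1 ∷ [])) ∷ ((4 ∷ 1 ∷ 5 ∷ 3 ∷ 6 ∷ []) , (3 ∷ 4 ∷ 6 ∷ 2 ∷ 3 ∷ 3 ∷ 1 ∷ 6 ∷ 5 ∷ [])) ∷ ((4 ∷ 1 ∷ 5 ∷ 3 ∷ 6 ∷ []) , (3 ∷ 4 ∷ 6 ∷ 2 ∷ 3 ∷ 3 ∷ 1 ∷ 0 ∷ 7 ∷ 5 ∷ [])) ∷ ((4 ∷ 1 ∷ 5 ∷ 3 ∷ 6 ∷ []) , (3 ∷ 4 ∷ 6 ∷ 2 ∷ 3 ∷ 3 ∷ 1 ∷ 0 ∷ 7 ∷ 6 ∷ 5 ∷ [])) ∷ ((4 ∷ 1 ∷ 5 ∷ 3 ∷ 6 ∷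 []) , (3 ∷ 4 ∷ 6 ∷ 2 ∷ 3 ∷ 3 ∷ 1 ∷ 0 ∷ 7 ∷ 6 ∷ 1 ∷ 2 ∷ [])) ∷ ((4 ∷ 1 ∷ 5 ∷ 3 ∷ 6 ∷ []) , (3 ∷ 4 ∷ 6 ∷ 2 ∷ 3 ∷ 3 ∷ 1 ∷ 0 ∷ 7 ∷ 6 ∷ 1 ∷ 7 ∷ 2 ∷ [])) ∷ ((4 ∷ 1 ∷ 5 ∷ 3 ∷ 6 ∷ []) , (3 ∷ 4 ∷ 6 ∷ 2 ∷ 3 ∷ 3 ∷ 1 ∷ 0 ∷ 7 ∷ 6 ∷ 1 ∷ 7 ∷ 2 ∷ 2 ∷ [])) ∷ ((4 ∷ 1 ∷ 5 ∷ 3 ∷ 6 ∷ []) , (3 ∷ 4 ∷ 6 ∷ 2 ∷ 3 ∷ 3 ∷ 1 ∷ 0 ∷ 7 ∷ 6 ∷ 1 ∷ 7 ∷ 2 ∷ 2 ∷ 5 ∷ [])) ∷ ((4 ∷ 1 ∷ 5 ∷ 3 ∷ 6 ∷ []) , (3 ∷ 4 ∷ 6 ∷ 2 ∷ 3 ∷ 3 ∷ 1 ∷ 0 ∷ 7 ∷ 6 ∷ 1 ∷ 7 ∷ 2 ∷ 2 ∷ 4 ∷ 5 ∷ [])) ∷ ((4 ∷ 1 ∷ 5 ∷ 3 ∷ 6 ∷ []) , (3 ∷ 4 ∷ 6 ∷ 2 ∷ 3 ∷ 3 ∷ 1 ∷ 0 ∷ 7 ∷ 6 ∷ 1 ∷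 7 ∷ 2 ∷ 2 ∷ 4 ∷ 7 ∷ 5 ∷ [])) ∷ ((4 ∷ 1 ∷ 5 ∷ 3 ∷ 6 ∷ []) , (3 ∷ 4 ∷ 6 ∷ 2 ∷ 3 ∷ 3 ∷ 1 ∷ 0 ∷ 7 ∷ 6 ∷ 1 ∷ 7 ∷ 2 ∷ 2 ∷ 4 ∷ 7 ∷ 5 ∷ 5 ∷ [])) ∷ ((4 ∷ 1 ∷ 5 ∷ 3 ∷ 6 ∷ []) , (3 ∷ 4 ∷ 6 ∷ 2 ∷ 3 ∷ 3 ∷ 1 ∷ 0 ∷ 7 ∷ 6 ∷ 1 ∷ 7 ∷ 2 ∷ 2 ∷ 4 ∷ 7 ∷ 5 ∷ 5 ∷ 2 ∷ [])) ∷ ((4 ∷ 1 ∷ 5 ∷ 3 ∷ 6 ∷ []) , (3 ∷ 4 ∷ 6 ∷ 2 ∷ 3 ∷ 3 ∷ 1 ∷ 0 ∷ 7 ∷ 6 ∷ 1 ∷ 7 ∷ 2 ∷ 2 ∷ 4 ∷ 7 ∷ 7 ∷ 5 ∷ 5 ∷ 2 ∷ [])) ∷ ((4 ∷ 1 ∷ 5 ∷ 3 ∷ 6 ∷ []) , (3 ∷ 4 ∷ 6 ∷ 2 ∷ 3 ∷ 3 ∷ 1 ∷ 0 ∷ 7 ∷ 6 ∷ 1 ∷ 7 ∷ 2 ∷ 2 ∷ 4 ∷ 4 ∷ 7 ∷ 7 ∷ 5 ∷ 5 ∷ 2 ∷ [])) ∷ ((4 ∷ 1 ∷ 5 ∷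 3 ∷ 6 ∷ []) , (3 ∷ 4 ∷ 6 ∷ 2 ∷ 3 ∷ 3 ∷ 1 ∷ 0 ∷ 7 ∷ 6 ∷ 1 ∷ 1 ∷ 7 ∷ 5 ∷ 2 ∷ 2 ∷ 7 ∷ 7 ∷ 4 ∷ 4 ∷ 5 ∷ 5 ∷ [])) ∷ ((4 ∷ 1 ∷ 5 ∷ 3 ∷ 6 ∷ []) , (3 ∷ 4 ∷ 6 ∷ 2 ∷ 3 ∷ 3 ∷ 1 ∷ 0 ∷ 7 ∷ 6 ∷ 6 ∷ 5 ∷ 4 ∷ 4 ∷ 2 ∷ 7 ∷ 7 ∷ 1 ∷ 1 ∷ 2 ∷ 2 ∷ 5 ∷ 5 ∷ [])) ∷ ((4 ∷ 1 ∷ 5 ∷ 3 ∷ 6 ∷ []) , (3 ∷ 4 ∷ 6 ∷ 2 ∷ 3 ∷ 3 ∷ 1 ∷ 0 ∷ 7 ∷ 6 ∷ 6 ∷ 5 ∷ 5 ∷ 2 ∷ 2 ∷ 7 ∷ 5 ∷ 4 ∷ 4 ∷ 7 ∷ 7 ∷ 1 ∷ 1 ∷ 2 ∷ [])) ∷ [])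
  ∷ (∅ ∷ ∅ ∷ ∅ ∷ ∅ ∷ ∅ ∷ ∅ ∷ ∅ ∷ ((4 ∷ 1 ∷ 5 ∷ 3 ∷ 6 ∷ 7 ∷ []) , (1 ∷ 6 ∷ 6 ∷ 4 ∷ 7 ∷ 3 ∷ [])) ∷ ((4 ∷ 1 ∷ 5 ∷ 3 ∷ 6 ∷ 7 ∷ []) , (1 ∷ 6 ∷ 6 ∷ 4 ∷ 7 ∷ 3 ∷ 2 ∷ [])) ∷ ((4 ∷ 1 ∷ 5 ∷ 3 ∷ 6 ∷ 7 ∷ []) , (1 ∷ 6 ∷ 6 ∷ 4 ∷ 7 ∷ 3 ∷ 2 ∷ 2 ∷ [])) ∷ ((4 ∷ 1 ∷ 5 ∷ 3 ∷ 6 ∷ 7 ∷ []) , (1 ∷ 6 ∷ 6 ∷ 4 ∷ 7 ∷ 3 ∷ 2 ∷ 1 ∷ 3 ∷ [])) ∷ ((4 ∷ 1 ∷ 5 ∷ 3 ∷ 6 ∷ 7 ∷ []) , (1 ∷ 6 ∷ 6 ∷ 4 ∷ 7 ∷ 3 ∷ 2 ∷ 1 ∷ 7 ∷ 5 ∷ [])) ∷ ((4 ∷ 1 ∷ 5 ∷ 3 ∷ 6 ∷ 7 ∷ []) , (1 ∷ 6 ∷ 6 ∷ 4 ∷ 7 ∷ 3 ∷ 2 ∷ 1 ∷ 7 ∷ 5 ∷ 2 ∷ [])) ∷ ((4 ∷ 1 ∷ 5 ∷ 3 ∷ 6 ∷ 7 ∷ []) , (1 ∷ 6 ∷ 6 ∷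 4 ∷ 7 ∷ 3 ∷ 2 ∷ 1 ∷ 7 ∷ 5 ∷ 2 ∷ 2 ∷ [])) ∷ ((4 ∷ 1 ∷ 5 ∷ 3 ∷ 6 ∷ 7 ∷ []) , (1 ∷ 6 ∷ 6 ∷ 4 ∷ 7 ∷ 3 ∷ 2 ∷ 1 ∷ 7 ∷ 5 ∷ 2 ∷ 4 ∷ 3 ∷ [])) ∷ ((4 ∷ 1 ∷ 5 ∷ 3 ∷ 6 ∷ 7 ∷ []) , (1 ∷ 6 ∷ 6 ∷ 4 ∷ 7 ∷ 3 ∷ 2 ∷ 1 ∷ 7 ∷ 5 ∷ 2 ∷ 0 ∷ 6 ∷ 5 ∷ [])) ∷ ((4 ∷ 1 ∷ 5 ∷ 3 ∷ 6 ∷ 7 ∷ []) , (1 ∷ 6 ∷ 6 ∷ 4 ∷ 7 ∷ 3 ∷ 2 ∷ 1 ∷ 7 ∷ 5 ∷ 2 ∷ 0 ∷ 6 ∷ 5 ∷ 5 ∷ [])) ∷ ((4 ∷ 1 ∷ 5 ∷ 3 ∷ 6 ∷ 7 ∷ []) , (1 ∷ 6 ∷ 6 ∷ 4 ∷ 7 ∷ 3 ∷ 2 ∷ 1 ∷ 7 ∷ 5 ∷ 2 ∷ 0 ∷ 6 ∷ 2 ∷ 4 ∷ 3 ∷ [])) ∷ ((4 ∷ 1 ∷ 5 ∷ 3 ∷ 6 ∷ 7 ∷ []) , (1 ∷ 6 ∷ 6 ∷ 4 ∷ 7 ∷ 3 ∷ 2 ∷ 1 ∷ 7 ∷ 5 ∷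 2 ∷ 0 ∷ 6 ∷ 2 ∷ 4 ∷ 4 ∷ 3 ∷ [])) ∷ ((4 ∷ 1 ∷ 5 ∷ 3 ∷ 6 ∷ 7 ∷ []) , (1 ∷ 6 ∷ 6 ∷ 4 ∷ 7 ∷ 3 ∷ 2 ∷ 1 ∷ 7 ∷ 5 ∷ 2 ∷ 0 ∷ 6 ∷ 2 ∷ 4 ∷ 4 ∷ 3 ∷ 3 ∷ [])) ∷ ((4 ∷ 1 ∷ 5 ∷ 3 ∷ 6 ∷ 7 ∷ []) , (1 ∷ 6 ∷ 6 ∷ 4 ∷ 7 ∷ 3 ∷ 2 ∷ 1 ∷ 7 ∷ 5 ∷ 2 ∷ 0 ∷ 6 ∷ 2 ∷ 2 ∷ 4 ∷ 4 ∷ 3 ∷ 3 ∷ [])) ∷ ((4 ∷ 1 ∷ 5 ∷ 3 ∷ 6 ∷ 7 ∷ []) , (1 ∷ 6 ∷ 6 ∷ 4 ∷ 7 ∷ 3 ∷ 2 ∷ 1 ∷ 7 ∷ 5 ∷ 2 ∷ 0 ∷ 3 ∷ 4 ∷ 4 ∷ 2 ∷ 2 ∷ 6 ∷ 5 ∷ 5 ∷ [])) ∷ ((4 ∷ 1 ∷ 5 ∷ 3 ∷ 6 ∷ 7 ∷ []) , (1 ∷ 6 ∷ 6 ∷ 4 ∷ 7 ∷ 3 ∷ 2 ∷ 1 ∷ 7 ∷ 5 ∷ 2 ∷ 0 ∷ 3 ∷ 3 ∷ 4 ∷ 4 ∷ 2 ∷ 2 ∷ 6 ∷ 5 ∷ 5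 ∷ [])) ∷ ((4 ∷ 1 ∷ 5 ∷ 3 ∷ 6 ∷ 7 ∷ []) , (1 ∷ 6 ∷ 6 ∷ 4 ∷ 7 ∷ 3 ∷ 2 ∷ 1 ∷ 7 ∷ 7 ∷ 5 ∷ 6 ∷ 2 ∷ 0 ∷ 5 ∷ 5 ∷ 2 ∷ 2 ∷ 4 ∷ 4 ∷ 3 ∷ 3 ∷ [])) ∷ ((2 ∷ 1 ∷ 1 ∷ 6 ∷ 5 ∷ 5 ∷ []) , (4 ∷ 4 ∷ 1 ∷ 7 ∷ 6 ∷ 3 ∷ 1 ∷ 0 ∷ 3 ∷ 4 ∷ 2 ∷ 5 ∷ 4 ∷ 7 ∷ 5 ∷ 3 ∷ 3 ∷ 7 ∷ 7 ∷ 2 ∷ 2 ∷ 6 ∷ 6 ∷ [])) ∷ [])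
  ∷ (∅ ∷ ∅ ∷ ∅ ∷ ∅ ∷ ∅ ∷ ∅ ∷ ∅ ∷ ∅ ∷ ((4 ∷ 1 ∷ 5 ∷ 3 ∷ 0 ∷ 1 ∷ 2 ∷ []) , (5 ∷ 6 ∷ 2 ∷ 3 ∷ 3 ∷ 1 ∷ 6 ∷ [])) ∷ ((4 ∷ 1 ∷ 5 ∷ 3 ∷ 0 ∷ 1 ∷ 2 ∷ []) , (5 ∷ 6 ∷ 2 ∷ 3 ∷ 3 ∷ 1 ∷ 6 ∷ 7 ∷ [])) ∷ ((4 ∷ 1 ∷ 5 ∷ 3 ∷ 0 ∷ 1 ∷ 2 ∷ []) , (5 ∷ 6 ∷ 2 ∷ 3 ∷ 3 ∷ 1 ∷ 6 ∷ 3 ∷ 7 ∷ [])) ∷ ((4 ∷ 1 ∷ 5 ∷ 3 ∷ 0 ∷ 1 ∷ 2 ∷ []) , (5 ∷ 6 ∷ 2 ∷ 3 ∷ 3 ∷ 1 ∷ 6 ∷ 3 ∷ 7 ∷ 7 ∷ [])) ∷ ((4 ∷ 1 ∷ 5 ∷ 3 ∷ 0 ∷ 1 ∷ 2 ∷ []) , (5 ∷ 6 ∷ 2 ∷ 3 ∷ 3 ∷ 1 ∷ 6 ∷ 3 ∷ 7 ∷ 7 ∷ 6 ∷ [])) ∷ ((4 ∷ 1 ∷ 5 ∷ 3 ∷ 0 ∷ 1 ∷ 2 ∷ []) , (5 ∷ 6 ∷ 2 ∷ 3 ∷ 3 ∷ 1 ∷ 6 ∷ 3 ∷ 7 ∷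 7 ∷ 4 ∷ 6 ∷ [])) ∷ ((4 ∷ 1 ∷ 5 ∷ 3 ∷ 0 ∷ 1 ∷ 2 ∷ []) , (5 ∷ 6 ∷ 2 ∷ 3 ∷ 3 ∷ 1 ∷ 6 ∷ 3 ∷ 7 ∷ 7 ∷ 4 ∷ 2 ∷ 7 ∷ [])) ∷ ((4 ∷ 1 ∷ 5 ∷ 3 ∷ 0 ∷ 1 ∷ 2 ∷ []) , (5 ∷ 6 ∷ 2 ∷ 3 ∷ 3 ∷ 1 ∷ 6 ∷ 3 ∷ 7 ∷ 7 ∷ 4 ∷ 2 ∷ 2 ∷ 7 ∷ [])) ∷ ((4 ∷ 1 ∷ 5 ∷ 3 ∷ 0 ∷ 1 ∷ 2 ∷ []) , (5 ∷ 6 ∷ 2 ∷ 3 ∷ 3 ∷ 1 ∷ 6 ∷ 3 ∷ 7 ∷ 7 ∷ 4 ∷ 2 ∷ 2 ∷ 5 ∷ 7 ∷ [])) ∷ ((4 ∷ 1 ∷ 5 ∷ 3 ∷ 0 ∷ 1 ∷ 2 ∷ []) , (5 ∷ 6 ∷ 2 ∷ 3 ∷ 3 ∷ 1 ∷ 6 ∷ 3 ∷ 7 ∷ 7 ∷ 4 ∷ 2 ∷ 2 ∷ 5 ∷ 5 ∷ 7 ∷ [])) ∷ ((4 ∷ 1 ∷ 5 ∷ 3 ∷ 0 ∷ 1 ∷ 2 ∷ []) , (5 ∷ 6 ∷ 2 ∷ 3 ∷ 3 ∷ 1 ∷ 6 ∷ 3 ∷ 7 ∷ 7 ∷ 4 ∷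 2 ∷ 2 ∷ 5 ∷ 5 ∷ 7 ∷ 6 ∷ [])) ∷ ((4 ∷ 1 ∷ 5 ∷ 3 ∷ 0 ∷ 1 ∷ 2 ∷ []) , (5 ∷ 6 ∷ 2 ∷ 3 ∷ 3 ∷ 1 ∷ 6 ∷ 3 ∷ 7 ∷ 7 ∷ 4 ∷ 2 ∷ 2 ∷ 5 ∷ 5 ∷ 7 ∷ 6 ∷ 6 ∷ [])) ∷ ((4 ∷ 1 ∷ 5 ∷ 3 ∷ 0 ∷ 1 ∷ 2 ∷ []) , (5 ∷ 6 ∷ 2 ∷ 3 ∷ 3 ∷ 1 ∷ 6 ∷ 3 ∷ 7 ∷ 7 ∷ 4 ∷ 2 ∷ 2 ∷ 5 ∷ 5 ∷ 4 ∷ 4 ∷ 6 ∷ 7 ∷ [])) ∷ ((4 ∷ 1 ∷ 5 ∷ 3 ∷ 0 ∷ 1 ∷ 2 ∷ []) , (5 ∷ 6 ∷ 2 ∷ 3 ∷ 3 ∷ 1 ∷ 6 ∷ 3 ∷ 7 ∷ 7 ∷ 4 ∷ 2 ∷ 2 ∷ 5 ∷ 5 ∷ 4 ∷ 4 ∷ 6 ∷ 6 ∷ 7 ∷ [])) ∷ ((4 ∷ 1 ∷ 5 ∷ 3 ∷ 0 ∷ 1 ∷ 2 ∷ []) , (5 ∷ 6 ∷ 2 ∷ 3 ∷ 3 ∷ 1 ∷ 6 ∷ 3 ∷ 7 ∷ 7 ∷ 4 ∷ 2 ∷ 2 ∷ 7 ∷ 5 ∷ 5 ∷ 4 ∷ 4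 ∷ 6 ∷ 6 ∷ 7 ∷ [])) ∷ ((1 ∷ 5 ∷ 4 ∷ 7 ∷ 0 ∷ 2 ∷ 6 ∷ []) , (5 ∷ 5 ∷ 2 ∷ 4 ∷ 4 ∷ 1 ∷ 6 ∷ 6 ∷ 3 ∷ 1 ∷ 1 ∷ 7 ∷ 3 ∷ 2 ∷ 2 ∷ 7 ∷ 7 ∷ 6 ∷ 5 ∷ 3 ∷ 3 ∷ 4 ∷ [])) ∷ [])
  ∷ (∅ ∷ ∅ ∷ ∅ ∷ ∅ ∷ ∅ ∷ ∅ ∷ ∅ ∷ ∅ ∷ ∅ ∷ ((4 ∷ 1 ∷ 5 ∷ 3 ∷ 0 ∷ 1 ∷ 2 ∷ 2 ∷ []) , (5 ∷ 7 ∷ 3 ∷ 1 ∷ 6 ∷ 3 ∷ 4 ∷ 7 ∷ [])) ∷ ((4 ∷ 1 ∷ 5 ∷ 3 ∷ 0 ∷ 1 ∷ 2 ∷ 2 ∷ []) , (5 ∷ 7 ∷ 3 ∷ 1 ∷ 6 ∷ 3 ∷ 4 ∷ 7 ∷ 7 ∷ [])) ∷ ((4 ∷ 1 ∷ 5 ∷ 3 ∷ 0 ∷ 1 ∷ 2 ∷ 2 ∷ []) , (5 ∷ 7 ∷ 3 ∷ 1 ∷ 6 ∷ 3 ∷ 4 ∷ 7 ∷ 7 ∷ 6 ∷ [])) ∷ ((4 ∷ 1 ∷ 5 ∷ 3 ∷ 0 ∷ 1 ∷ 2 ∷ 2 ∷ []) , (5 ∷ 7 ∷ 3 ∷ 1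 ∷ 6 ∷ 3 ∷ 4 ∷ 7 ∷ 7 ∷ 2 ∷ 6 ∷ [])) ∷ ((4 ∷ 1 ∷ 5 ∷ 3 ∷ 0 ∷ 1 ∷ 2 ∷ 2 ∷ []) , (5 ∷ 7 ∷ 3 ∷ 1 ∷ 6 ∷ 3 ∷ 4 ∷ 7 ∷ 7 ∷ 2 ∷ 4 ∷ 6 ∷ [])) ∷ ((4 ∷ 1 ∷ 5 ∷ 3 ∷ 0 ∷ 1 ∷ 2 ∷ 2 ∷ []) , (5 ∷ 7 ∷ 3 ∷ 1 ∷ 6 ∷ 3 ∷ 4 ∷ 7 ∷ 7 ∷ 2 ∷ 4 ∷ 4 ∷ 6 ∷ [])) ∷ ((4 ∷ 1 ∷ 5 ∷ 3 ∷ 0 ∷ 1 ∷ 2 ∷ 2 ∷ []) , (5 ∷ 7 ∷ 3 ∷ 1 ∷ 6 ∷ 3 ∷ 4 ∷ 7 ∷ 7 ∷ 2 ∷ 4 ∷ 4 ∷ 5 ∷ 6 ∷ [])) ∷ ((4 ∷ 1 ∷ 5 ∷ 3 ∷ 0 ∷ 1 ∷ 2 ∷ 2 ∷ []) , (5 ∷ 7 ∷ 3 ∷ 1 ∷ 6 ∷ 3 ∷ 4 ∷ 7 ∷ 7 ∷ 2 ∷ 4 ∷ 4 ∷ 5 ∷ 5 ∷ 6 ∷ [])) ∷ ((4 ∷ 1 ∷ 5 ∷ 3 ∷ 0 ∷ 1 ∷ 2 ∷ 2 ∷ []) , (5 ∷ 7 ∷ 3 ∷ 1 ∷ 6 ∷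 3 ∷ 4 ∷ 7 ∷ 7 ∷ 2 ∷ 4 ∷ 4 ∷ 5 ∷ 5 ∷ 2 ∷ 6 ∷ [])) ∷ ((4 ∷ 1 ∷ 5 ∷ 3 ∷ 0 ∷ 1 ∷ 2 ∷ 2 ∷ []) , (5 ∷ 7 ∷ 3 ∷ 1 ∷ 6 ∷ 3 ∷ 4 ∷ 7 ∷ 7 ∷ 2 ∷ 4 ∷ 4 ∷ 5 ∷ 5 ∷ 2 ∷ 6 ∷ 6 ∷ [])) ∷ ((4 ∷ 1 ∷ 5 ∷ 3 ∷ 0 ∷ 1 ∷ 2 ∷ 2 ∷ []) , (5 ∷ 7 ∷ 3 ∷ 1 ∷ 6 ∷ 3 ∷ 4 ∷ 7 ∷ 7 ∷ 2 ∷ 4 ∷ 4 ∷ 5 ∷ 5 ∷ 2 ∷ 6 ∷ 6 ∷ 7 ∷ [])) ∷ ((4 ∷ 1 ∷ 5 ∷ 3 ∷ 0 ∷ 1 ∷ 2 ∷ 2 ∷ []) , (5 ∷ 7 ∷ 3 ∷ 1 ∷ 6 ∷ 3 ∷ 4 ∷ 7 ∷ 7 ∷ 2 ∷ 4 ∷ 4 ∷ 6 ∷ 6 ∷ 5 ∷ 5 ∷ 2 ∷ 6 ∷ 7 ∷ [])) ∷ ((4 ∷ 7 ∷ 0 ∷ 2 ∷ 1 ∷ 1 ∷ 6 ∷ 5 ∷ []) , (1 ∷ 4 ∷ 4 ∷ 3 ∷ 6 ∷ 6 ∷ 7 ∷ 1 ∷ 5 ∷ 3 ∷ 7 ∷ 2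 ∷ 5 ∷ 5 ∷ 4 ∷ 6 ∷ 2 ∷ 2 ∷ 3 ∷ 3 ∷ [])) ∷ ((4 ∷ 7 ∷ 0 ∷ 2 ∷ 1 ∷ 1 ∷ 6 ∷ 5 ∷ []) , (1 ∷ 4 ∷ 4 ∷ 3 ∷ 6 ∷ 6 ∷ 7 ∷ 1 ∷ 5 ∷ 3 ∷ 7 ∷ 7 ∷ 5 ∷ 5 ∷ 2 ∷ 4 ∷ 6 ∷ 2 ∷ 2 ∷ 3 ∷ 3 ∷ [])) ∷ [])
  ∷ (∅ ∷ ∅ ∷ ∅ ∷ ∅ ∷ ∅ ∷ ∅ ∷ ∅ ∷ ∅ ∷ ∅ ∷ ∅ ∷ ((4 ∷ 1 ∷ 5 ∷ 3 ∷ 0 ∷ 1 ∷ 2 ∷ 3 ∷ 6 ∷ []) , (2 ∷ 6 ∷ 7 ∷ 7 ∷ 4 ∷ 4 ∷ 2 ∷ 2 ∷ 5 ∷ [])) ∷ ((4 ∷ 1 ∷ 5 ∷ 3 ∷ 0 ∷ 1 ∷ 2 ∷ 3 ∷ 6 ∷ []) , (2 ∷ 6 ∷ 7 ∷ 7 ∷ 4 ∷ 4 ∷ 2 ∷ 2 ∷ 5 ∷ 5 ∷ [])) ∷ ((4 ∷ 1 ∷ 5 ∷ 3 ∷ 0 ∷ 1 ∷ 2 ∷ 3 ∷ 6 ∷ []) , (2 ∷ 6 ∷ 7 ∷ 7 ∷ 4 ∷ 4 ∷ 2 ∷ 2 ∷ 5 ∷ 5 ∷ 7 ∷ [])) ∷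 ((4 ∷ 1 ∷ 5 ∷ 3 ∷ 0 ∷ 1 ∷ 2 ∷ 3 ∷ 6 ∷ []) , (2 ∷ 6 ∷ 7 ∷ 7 ∷ 4 ∷ 4 ∷ 2 ∷ 2 ∷ 5 ∷ 4 ∷ 3 ∷ 7 ∷ [])) ∷ ((4 ∷ 1 ∷ 5 ∷ 3 ∷ 0 ∷ 1 ∷ 2 ∷ 3 ∷ 6 ∷ []) , (2 ∷ 6 ∷ 7 ∷ 7 ∷ 4 ∷ 4 ∷ 2 ∷ 2 ∷ 5 ∷ 5 ∷ 4 ∷ 6 ∷ 5 ∷ [])) ∷ ((4 ∷ 1 ∷ 5 ∷ 3 ∷ 0 ∷ 1 ∷ 2 ∷ 3 ∷ 6 ∷ []) , (2 ∷ 6 ∷ 7 ∷ 7 ∷ 4 ∷ 4 ∷ 2 ∷ 2 ∷ 5 ∷ 5 ∷ 7 ∷ 3 ∷ 4 ∷ 5 ∷ [])) ∷ ((4 ∷ 1 ∷ 5 ∷ 3 ∷ 0 ∷ 1 ∷ 2 ∷ 3 ∷ 6 ∷ []) , (2 ∷ 6 ∷ 7 ∷ 7 ∷ 4 ∷ 4 ∷ 2 ∷ 2 ∷ 5 ∷ 5 ∷ 7 ∷ 3 ∷ 3 ∷ 4 ∷ 5 ∷ [])) ∷ ((4 ∷ 1 ∷ 5 ∷ 3 ∷ 0 ∷ 1 ∷ 2 ∷ 3 ∷ 6 ∷ []) , (2 ∷ 6 ∷ 7 ∷ 7 ∷ 4 ∷ 4 ∷ 2 ∷ 2 ∷ 5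 ∷ 5 ∷ 7 ∷ 3 ∷ 4 ∷ 6 ∷ 1 ∷ 7 ∷ [])) ∷ ((4 ∷ 1 ∷ 5 ∷ 3 ∷ 0 ∷ 1 ∷ 2 ∷ 3 ∷ 6 ∷ []) , (2 ∷ 6 ∷ 7 ∷ 7 ∷ 4 ∷ 4 ∷ 2 ∷ 2 ∷ 5 ∷ 5 ∷ 7 ∷ 3 ∷ 3 ∷ 1 ∷ 1 ∷ 6 ∷ 5 ∷ [])) ∷ ((4 ∷ 1 ∷ 5 ∷ 3 ∷ 0 ∷ 1 ∷ 2 ∷ 3 ∷ 6 ∷ []) , (2 ∷ 6 ∷ 7 ∷ 7 ∷ 4 ∷ 4 ∷ 2 ∷ 2 ∷ 5 ∷ 5 ∷ 7 ∷ 3 ∷ 4 ∷ 5 ∷ 6 ∷ 1 ∷ 1 ∷ 7 ∷ [])) ∷ ((4 ∷ 1 ∷ 5 ∷ 3 ∷ 0 ∷ 1 ∷ 2 ∷ 3 ∷ 6 ∷ []) , (2 ∷ 6 ∷ 7 ∷ 7 ∷ 4 ∷ 4 ∷ 2 ∷ 2 ∷ 5 ∷ 5 ∷ 7 ∷ 3 ∷ 4 ∷ 5 ∷ 6 ∷ 6 ∷ 1 ∷ 1 ∷ 7 ∷ [])) ∷ ((4 ∷ 1 ∷ 5 ∷ 3 ∷ 0 ∷ 1 ∷ 2 ∷ 3 ∷ 6 ∷ []) , (2 ∷ 6 ∷ 7 ∷ 7 ∷ 4 ∷ 4 ∷ 2 ∷ 2 ∷ 5 ∷ 5 ∷ 7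 ∷ 3 ∷ 3 ∷ 4 ∷ 5 ∷ 6 ∷ 6 ∷ 1 ∷ 1 ∷ 7 ∷ [])) ∷ [])
  ∷ (∅ ∷ ∅ ∷ ∅ ∷ ∅ ∷ ∅ ∷ ∅ ∷ ∅ ∷ ∅ ∷ ∅ ∷ ∅ ∷ ∅ ∷ ((4 ∷ 1 ∷ 5 ∷ 3 ∷ 0 ∷ 1 ∷ 2 ∷ 3 ∷ 4 ∷ 6 ∷ []) , (7 ∷ 3 ∷ 1 ∷ 6 ∷ 7 ∷ 4 ∷ 2 ∷ 2 ∷ 6 ∷ 5 ∷ [])) ∷ ((4 ∷ 1 ∷ 5 ∷ 3 ∷ 0 ∷ 1 ∷ 2 ∷ 3 ∷ 4 ∷ 6 ∷ []) , (7 ∷ 3 ∷ 1 ∷ 6 ∷ 7 ∷ 4 ∷ 2 ∷ 2 ∷ 6 ∷ 5 ∷ 2 ∷ [])) ∷ ((4 ∷ 1 ∷ 5 ∷ 3 ∷ 0 ∷ 1 ∷ 2 ∷ 3 ∷ 4 ∷ 6 ∷ []) , (7 ∷ 3 ∷ 1 ∷ 6 ∷ 7 ∷ 4 ∷ 2 ∷ 2 ∷ 6 ∷ 5 ∷ 7 ∷ 2 ∷ [])) ∷ ((4 ∷ 1 ∷ 5 ∷ 3 ∷ 0 ∷ 1 ∷ 2 ∷ 3 ∷ 4 ∷ 6 ∷ []) , (7 ∷ 3 ∷ 1 ∷ 6 ∷ 7 ∷ 4 ∷ 2 ∷ 2 ∷ 6 ∷ 5 ∷ 7 ∷ 7 ∷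 2 ∷ [])) ∷ ((4 ∷ 1 ∷ 5 ∷ 3 ∷ 0 ∷ 1 ∷ 2 ∷ 3 ∷ 4 ∷ 6 ∷ []) , (7 ∷ 3 ∷ 1 ∷ 6 ∷ 7 ∷ 4 ∷ 2 ∷ 2 ∷ 6 ∷ 5 ∷ 7 ∷ 7 ∷ 2 ∷ 5 ∷ [])) ∷ ((4 ∷ 1 ∷ 5 ∷ 3 ∷ 0 ∷ 1 ∷ 2 ∷ 3 ∷ 4 ∷ 6 ∷ []) , (7 ∷ 3 ∷ 1 ∷ 6 ∷ 7 ∷ 4 ∷ 2 ∷ 2 ∷ 6 ∷ 5 ∷ 7 ∷ 7 ∷ 2 ∷ 5 ∷ 5 ∷ [])) ∷ ((4 ∷ 1 ∷ 5 ∷ 3 ∷ 0 ∷ 1 ∷ 2 ∷ 3 ∷ 4 ∷ 6 ∷ []) , (7 ∷ 3 ∷ 1 ∷ 6 ∷ 7 ∷ 4 ∷ 2 ∷ 2 ∷ 6 ∷ 6 ∷ 5 ∷ 7 ∷ 7 ∷ 2 ∷ 5 ∷ 5 ∷ [])) ∷ ((4 ∷ 1 ∷ 5 ∷ 3 ∷ 0 ∷ 1 ∷ 2 ∷ 3 ∷ 4 ∷ 6 ∷ []) , (7 ∷ 3 ∷ 1 ∷ 6 ∷ 7 ∷ 4 ∷ 4 ∷ 5 ∷ 7 ∷ 7 ∷ 2 ∷ 5 ∷ 5 ∷ 6 ∷ 6 ∷ 2 ∷ 2 ∷ [])) ∷ ((7 ∷ 2 ∷ 2 ∷ 1 ∷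 1 ∷ 6 ∷ 5 ∷ 5 ∷ 2 ∷ 4 ∷ []) , (1 ∷ 4 ∷ 6 ∷ 3 ∷ 1 ∷ 7 ∷ 3 ∷ 4 ∷ 5 ∷ 7 ∷ 7 ∷ 6 ∷ 6 ∷ 0 ∷ 2 ∷ 3 ∷ 3 ∷ 5 ∷ [])) ∷ ((7 ∷ 2 ∷ 2 ∷ 1 ∷ 1 ∷ 6 ∷ 5 ∷ 5 ∷ 2 ∷ 4 ∷ []) , (1 ∷ 4 ∷ 6 ∷ 3 ∷ 1 ∷ 7 ∷ 3 ∷ 4 ∷ 4 ∷ 5 ∷ 3 ∷ 3 ∷ 0 ∷ 5 ∷ 7 ∷ 7 ∷ 6 ∷ 6 ∷ 2 ∷ [])) ∷ [])
  ∷ (∅ ∷ ∅ ∷ ∅ ∷ ∅ ∷ ∅ ∷ ∅ ∷ ∅ ∷ ∅ ∷ ∅ ∷ ∅ ∷ ∅ ∷ ∅ ∷ ((4 ∷ 1 ∷ 5 ∷ 3 ∷ 0 ∷ 1 ∷ 2 ∷ 3 ∷ 4 ∷ 6 ∷ 2 ∷ []) , (5 ∷ 2 ∷ 2 ∷ 7 ∷ 6 ∷ 3 ∷ 3 ∷ 1 ∷ 6 ∷ 5 ∷ 7 ∷ [])) ∷ ((4 ∷ 1 ∷ 5 ∷ 3 ∷ 0 ∷ 1 ∷ 2 ∷ 3 ∷ 4 ∷ 6 ∷ 2 ∷ []) , (5 ∷ 2 ∷ 2 ∷ 7 ∷ 6 ∷ 3 ∷ 1 ∷ 7 ∷ 4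 ∷ 4 ∷ 5 ∷ 7 ∷ [])) ∷ ((4 ∷ 1 ∷ 5 ∷ 3 ∷ 0 ∷ 1 ∷ 2 ∷ 3 ∷ 4 ∷ 6 ∷ 2 ∷ []) , (5 ∷ 2 ∷ 2 ∷ 7 ∷ 6 ∷ 3 ∷ 1 ∷ 7 ∷ 5 ∷ 4 ∷ 4 ∷ 7 ∷ 7 ∷ [])) ∷ ((4 ∷ 1 ∷ 5 ∷ 3 ∷ 0 ∷ 1 ∷ 2 ∷ 3 ∷ 4 ∷ 6 ∷ 2 ∷ []) , (5 ∷ 2 ∷ 2 ∷ 7 ∷ 6 ∷ 3 ∷ 7 ∷ 1 ∷ 1 ∷ 6 ∷ 5 ∷ 4 ∷ 4 ∷ 7 ∷ [])) ∷ ((4 ∷ 1 ∷ 5 ∷ 3 ∷ 0 ∷ 1 ∷ 2 ∷ 3 ∷ 4 ∷ 6 ∷ 2 ∷ []) , (5 ∷ 2 ∷ 2 ∷ 7 ∷ 6 ∷ 3 ∷ 7 ∷ 1 ∷ 1 ∷ 6 ∷ 5 ∷ 4 ∷ 4 ∷ 7 ∷ 7 ∷ [])) ∷ ((4 ∷ 1 ∷ 5 ∷ 3 ∷ 0 ∷ 1 ∷ 2 ∷ 3 ∷ 4 ∷ 6 ∷ 2 ∷ []) , (5 ∷ 2 ∷ 2 ∷ 7 ∷ 6 ∷ 3 ∷ 7 ∷ 1 ∷ 6 ∷ 6 ∷ 5 ∷ 5 ∷ 4 ∷ 4 ∷ 7 ∷ 7 ∷ [])) ∷ ((4 ∷ 1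 ∷ 5 ∷ 3 ∷ 0 ∷ 1 ∷ 2 ∷ 3 ∷ 4 ∷ 6 ∷ 2 ∷ []) , (5 ∷ 2 ∷ 2 ∷ 7 ∷ 6 ∷ 3 ∷ 7 ∷ 5 ∷ 5 ∷ 4 ∷ 4 ∷ 7 ∷ 7 ∷ 1 ∷ 1 ∷ 6 ∷ 6 ∷ [])) ∷ ((4 ∷ 1 ∷ 5 ∷ 3 ∷ 0 ∷ 1 ∷ 2 ∷ 3 ∷ 4 ∷ 6 ∷ 2 ∷ []) , (5 ∷ 2 ∷ 2 ∷ 7 ∷ 6 ∷ 3 ∷ 3 ∷ 7 ∷ 4 ∷ 4 ∷ 5 ∷ 5 ∷ 7 ∷ 7 ∷ 1 ∷ 1 ∷ 6 ∷ 6 ∷ [])) ∷ [])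
  ∷ (∅ ∷ ∅ ∷ ∅ ∷ ∅ ∷ ∅ ∷ ∅ ∷ ∅ ∷ ∅ ∷ ∅ ∷ ∅ ∷ ∅ ∷ ∅ ∷ ∅ ∷ ((4 ∷ 1 ∷ 5 ∷ 3 ∷ 0 ∷ 1 ∷ 2 ∷ 3 ∷ 4 ∷ 6 ∷ 2 ∷ 7 ∷ []) , (2 ∷ 2 ∷ 4 ∷ 7 ∷ 7 ∷ 3 ∷ 3 ∷ 1 ∷ 6 ∷ 5 ∷ 7 ∷ 6 ∷ [])) ∷ ((4 ∷ 1 ∷ 5 ∷ 3 ∷ 0 ∷ 1 ∷ 2 ∷ 3 ∷ 4 ∷ 6 ∷ 2 ∷ 7 ∷ []) , (2 ∷ 2 ∷ 4 ∷ 7 ∷ 7 ∷ 3 ∷ 3 ∷ 1 ∷ 6 ∷ 5 ∷ 7 ∷ 6 ∷ 6 ∷ [])) ∷ ((4 ∷ 1 ∷ 5 ∷ 3 ∷ 0 ∷ 1 ∷ 2 ∷ 3 ∷ 4 ∷ 6 ∷ 2 ∷ 7 ∷ []) , (2 ∷ 2 ∷ 4 ∷ 7 ∷ 7 ∷ 3 ∷ 3 ∷ 1 ∷ 6 ∷ 5 ∷ 5 ∷ 7 ∷ 6 ∷ 6 ∷ [])) ∷ ((4 ∷ 1 ∷ 5 ∷ 3 ∷ 0 ∷ 1 ∷ 2 ∷ 3 ∷ 4 ∷ 6 ∷ 2 ∷ 7 ∷ []) , (2 ∷ 2 ∷ 4 ∷ 7 ∷ 7 ∷ 3 ∷ 3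 ∷ 1 ∷ 1 ∷ 6 ∷ 6 ∷ 5 ∷ 5 ∷ 7 ∷ 6 ∷ [])) ∷ ((4 ∷ 1 ∷ 5 ∷ 3 ∷ 0 ∷ 1 ∷ 2 ∷ 3 ∷ 4 ∷ 6 ∷ 2 ∷ 7 ∷ []) , (2 ∷ 2 ∷ 4 ∷ 4 ∷ 7 ∷ 1 ∷ 1 ∷ 6 ∷ 5 ∷ 5 ∷ 7 ∷ 7 ∷ 3 ∷ 3 ∷ 6 ∷ 6 ∷ [])) ∷ ((4 ∷ 1 ∷ 5 ∷ 3 ∷ 0 ∷ 1 ∷ 2 ∷ 3 ∷ 4 ∷ 6 ∷ 2 ∷ 7 ∷ []) , (2 ∷ 2 ∷ 4 ∷ 4 ∷ 5 ∷ 5 ∷ 6 ∷ 6 ∷ 7 ∷ 3 ∷ 3 ∷ 6 ∷ 1 ∷ 1 ∷ 7 ∷ 7 ∷ 5 ∷ [])) ∷ [])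
  ∷ (∅ ∷ ∅ ∷ ∅ ∷ ∅ ∷ ∅ ∷ ∅ ∷ ∅ ∷ ∅ ∷ ∅ ∷ ∅ ∷ ∅ ∷ ∅ ∷ ∅ ∷ ∅ ∷ ((4 ∷ 1 ∷ 5 ∷ 3 ∷ 0 ∷ 1 ∷ 2 ∷ 3 ∷ 4 ∷ 6 ∷ 2 ∷ 7 ∷ 5 ∷ []) , (7 ∷ 6 ∷ 3 ∷ 7 ∷ 1 ∷ 1 ∷ 6 ∷ 6 ∷ 5 ∷ 4 ∷ 4 ∷ 2 ∷ 2 ∷ [])) ∷ ((4 ∷ 1 ∷ 5 ∷ 3 ∷ 0 ∷ 1 ∷ 2 ∷ 3 ∷ 4 ∷ 6 ∷ 2 ∷ 7 ∷ 5 ∷ []) , (7 ∷ 6 ∷ 3 ∷ 3 ∷ 1 ∷ 1 ∷ 6 ∷ 6 ∷ 5 ∷ 5 ∷ 4 ∷ 4 ∷ 2 ∷ 2 ∷ [])) ∷ ((4 ∷ 1 ∷ 5 ∷ 3 ∷ 0 ∷ 1 ∷ 2 ∷ 3 ∷ 4 ∷ 6 ∷ 2 ∷ 7 ∷ 5 ∷ []) , (7 ∷ 6 ∷ 3 ∷ 3 ∷ 7 ∷ 7 ∷ 1 ∷ 1 ∷ 6 ∷ 6 ∷ 5 ∷ 4 ∷ 4 ∷ 2 ∷ 2 ∷ [])) ∷ ((4 ∷ 1 ∷ 5 ∷ 3 ∷ 0 ∷ 1 ∷ 2 ∷ 3 ∷ 4 ∷ 6 ∷ 2 ∷ 7 ∷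 5 ∷ []) , (7 ∷ 6 ∷ 3 ∷ 3 ∷ 1 ∷ 1 ∷ 7 ∷ 7 ∷ 4 ∷ 4 ∷ 2 ∷ 2 ∷ 5 ∷ 5 ∷ 6 ∷ 6 ∷ [])) ∷ [])
  ∷ (∅ ∷ ∅ ∷ ∅ ∷ ∅ ∷ ∅ ∷ ∅ ∷ ∅ ∷ ∅ ∷ ∅ ∷ ∅ ∷ ∅ ∷ ∅ ∷ ∅ ∷ ∅ ∷ ∅ ∷ ((4 ∷ 1 ∷ 5 ∷ 3 ∷ 0 ∷ 1 ∷ 2 ∷ 3 ∷ 4 ∷ 6 ∷ 2 ∷ 7 ∷ 3 ∷ 6 ∷ []) , (7 ∷ 4 ∷ 4 ∷ 2 ∷ 2 ∷ 5 ∷ 6 ∷ 6 ∷ 1 ∷ 1 ∷ 7 ∷ 7 ∷ 5 ∷ 5 ∷ [])) ∷ ((5 ∷ 5 ∷ 2 ∷ 4 ∷ 4 ∷ 1 ∷ 6 ∷ 6 ∷ 3 ∷ 1 ∷ 2 ∷ 3 ∷ 4 ∷ 6 ∷ []) , (4 ∷ 7 ∷ 6 ∷ 5 ∷ 1 ∷ 1 ∷ 7 ∷ 0 ∷ 2 ∷ 2 ∷ 7 ∷ 7 ∷ 5 ∷ 3 ∷ 3 ∷ [])) ∷ [])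
  ∷ []
constructible₆ : Constructible 6 18
constructible₆ = ordered⇒constructible (covers-sound 5 18 table₆ _)

constructible₈ : Constructible 8 32
constructible₈ = ordered⇒constructible (covers-sound 7 32 table₈ _)

constructible-from-8 : ∀ m → Constructible ((4 + m) + (4 + m)) (2 * (4 + m) * (4 + m))
constructible-from-8 zero    = constructible₈
constructible-from-8 (suc m) =
  subst₂ Constructible (k-eq m) (B-eq m) (extend (3 + m) _ (room m) (constructible-from-8 m))
  where
  k-eq : ∀ m → 2 + ((4 + m) + (4 + m)) ≡ (5 + m) + (5 + m)
  k-eq = solve-∀
  B-eq : ∀ m → 2 * (4 + m) * (4 + m) + (6 + (3 + m) * 4) ≡ 2 * (5 + m) * (5 + m)
  B-eq = solve-∀
  room : ∀ m → (3 + m) * 4 + 15 ≤ 2 * (4 + m) * (4 + m)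
  room m = ≤-trans (m≤m+n _ (5 + 12 * m + 2 * m * m)) (≤-reflexive (eq m))
    where
    eq : ∀ m → (3 + m) * 4 + 15 + (5 + 12 * m + 2 * m * m) ≡ 2 * (4 + m) * (4 + m)
    eq = solve-∀

constructible : ∀ h → 3 ≤ h → Constructible (h + h) (2 * h * h)
constructible 1 (s≤s ())
constructible 2 (s≤s (s≤s ()))
constructible 3 _ = constructible₆
constructible (suc (suc (suc (suc m)))) _ = constructible-from-8 m

half : ∀ {k} → 2 ∣ k → Σ ℕ λ h → k ≡ h + h
half (divides h refl) = h , trans (*-comm h 2) (cong (h +_) (+-identityʳ h))

embeds⇒conditions : ∀ k c₂ c₃ → 2 ∣ k → 1 ≤ c₂ → c₂ ≤ c₃ → PetalEmbeds k c₂ c₃ →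
  6 ≤ k × 3 ≤ c₂ × 2 * (1 + c₂ + c₃) ≤ k * k
embeds⇒conditions k c₂ c₃ 2∣k 1≤c₂ c₂≤c₃ (f , emb) =
  Necessity.conditions (FromEmbedding.drawing f emb 1≤c₂ (≤-trans 1≤c₂ c₂≤c₃))
                       (proj₁ (half 2∣k)) (proj₂ (half 2∣k)) 1≤c₂ c₂≤c₃

conditions⇒embeds : ∀ k c₂ c₃ → 2 ∣ k → c₂ ≤ c₃ → 6 ≤ k × 3 ≤ c₂ × 2 * (1 + c₂ + c₃) ≤ k * k →
  PetalEmbeds k c₂ c₃
conditions⇒embeds k c₂ c₃ 2∣k c₂≤c₃ (6≤k , 3≤c₂ , edges) with half 2∣k
... | h , refl = ToEmbedding.embeds drawing (≤-trans (s≤s z≤n) 3≤c₂) (≤-trans (s≤s z≤n) 3≤c₃)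
  where
  3≤c₃ : 3 ≤ c₃
  3≤c₃ = ≤-trans 3≤c₂ c₂≤c₃
  3≤h : 3 ≤ h
  3≤h = *-cancelˡ-≤ 2 (subst (6 ≤_) (cong (h +_) (sym (+-identityʳ h))) 6≤k)
  bound : 1 + c₂ + c₃ ≤ 2 * h * h
  bound = *-cancelˡ-≤ 2 (subst (2 * (1 + c₂ + c₃) ≤_) (eq h) edges)
    where
    eq : ∀ h → (h + h) * (h + h) ≡ 2 * (2 * h * h)
    eq = solve-∀
  drawing : Drawing (h + h) 0 c₂ c₃
  drawing = constructible h 3≤h c₂ c₃ 3≤c₂ 3≤c₃ bound

theorem3p1 : (k c2 c3 : ℕ) → 2 ∣ k → 1 ≤ k → 1 ≤ c2 → c2 ≤ c3 →
  (PetalEmbeds k c2 c3 ⇔ (6 ≤ k × 3 ≤ c2 × 2 * (1 + c2 + c3) ≤ k * k))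
theorem3p1 k c₂ c₃ 2∣k _ 1≤c₂ c₂≤c₃ =
  mk⇔ (embeds⇒conditions k c₂ c₃ 2∣k 1≤c₂ c₂≤c₃) (conditions⇒embeds k c₂ c₃ 2∣k c₂≤c₃)
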